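{- Let $G$ be a graph with a list assignment $L$ (a set $L(x)$ of colors for each $x\in V(G)\cup E(G)$). Suppose $G$ contains a cycle $u_1u_2u_3u_4$ with $u_1u_3,u_2u_4\in E(G)$ and $d(u_2)=d(u_4)=3$. Let $\varphi'$ be a partial $L$-total coloring of $G$ whose uncolored elements are exactly $u_1u_2,u_2u_3,u_3u_4,u_1u_4,u_2u_4,u_1u_3,u_1,u_2,u_3$ and $u_4$. If $\min\{|L_{av}(u_2,\varphi')|,|L_{av}(u_4,\varphi')|,|L_{av}(u_2u_4,\varphi')|\}\geq 6$, $\min\{|L_{av}(u_1u_2,\varphi')|,|L_{av}(u_2u_3,\varphi')|,|L_{av}(u_3u_4,\varphi')|,|L_{av}(u_1u_4,\varphi')|\}\geq 4$, $\min\{|L_{av}(u_1,\varphi')|,|L_{av}(u_3,\varphi')|,|L_{av}(u_1u_3,\varphi')|\}\geq 2$, and at least two of $L_{av}(u_1,\varphi'),L_{av}(u_3,\varphi'),L_{av}(u_1u_3,\varphi')$ are distinct whenever $|L_{av}(u_1,\varphi')|=|L_{av}(u_3,\varphi')|=|L_{av}(u_1u_3,\varphi')|=2$, then $\varphi'$ can be extended to an $L$-total coloring $\varphi$ of $G$ without altering the colors already assigned.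
   Context: A total coloring assigns colors to vertices and edges so that adjacent vertices, adjacent edges (sharing an endpoint), and a vertex and an incident edge receive different colors. An $L$-total coloring is a total coloring $\varphi$ with $\varphi(x)\in L(x)$ for every element $x$; a partial $L$-total coloring is such a coloring defined on a subset of the elements, proper among the colored elements. For an uncolored element $x$, the available list $L_{av}(x,\varphi')$ is the set of colors in $L(x)$ not used by $\varphi'$ on any colored element adjacent or incident to $x$. -}

module Defs where

open import Data.Nat using (ℕ)
open import Data.Nat.Properties using () renaming (_≟_ to _≟ℕ_)
open import Data.Bool using (Bool; true; false; T; if_then_else_; _∧_; not)
open import Data.Fin using (Fin)
open import Data.Fin.Properties using () renaming (_≟_ to _≟F_)
open import Data.List using (List; []; _∷_; _++_; length; filter; filterᵇ; concatMap; deduplicate; allFin)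
open import Data.List.Membership.Propositional using (_∈_)
open import Data.List.Membership.DecPropositional _≟ℕ_ using (_∈?_)
open import Data.Maybe using (Maybe; just; nothing)
open import Data.Product using (_×_; Σ; ∃)
open import Data.Sum using (_⊎_)
open import Data.Empty using (⊥)
open import Relation.Nullary using (¬_; ¬?)
open import Relation.Nullary.Decidable using (⌊_⌋)
open import Relation.Binary.PropositionalEquality using (_≡_; _≢_)
open import Function using (_⇔_)

record Graph : Set where
  field
    n      : ℕ
    adj    : Fin n → Fin n → Bool
    sym    : ∀ u v → adj u v ≡ adj v u
    irrefl : ∀ v → adj v v ≡ false
open Graph public

Vtx : Graph → Set
Vtx G = Fin (n G)

Edge : (G : Graph) → Vtx G → Vtx G → Set
Edge G u v = T (adj G u v)

deg : (G : Graph) → Vtx G → ℕ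
deg G v = length (filterᵇ (adj G v) (allFin (n G)))

-- Colours are natural numbers; colour sets (lists L(x)) are finite sets,
-- represented by lists read as sets (membership only matters).
ColSet : Set
ColSet = List ℕ

card : ColSet → ℕ
card xs = length (deduplicate _≟ℕ_ xs)

_≈ₛ_ : ColSet → ColSet → Set
A ≈ₛ B = ∀ c → (c ∈ A) ⇔ (c ∈ B)

-- A list assignment: a list for every vertex and every edge.
-- The edge uv is addressed by both ordered pairs (u,v), (v,u); on edges
-- the two must agree.  Values on non-edges are irrelevant.
record ListAssignment (G : Graph) : Set where
  field
    Lv   : Vtx G → ColSet
    Le   : Vtx G → Vtx G → ColSet
    Lsym : ∀ u v → Edge G u v → Le u v ≡ Le v u
open ListAssignment public

record PartialCol (G : Graph) : Set where
  field
    pv : Vtx G → Maybe ℕ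
    pe : Vtx G → Vtx G → Maybe ℕ
open PartialCol public

Differ : Maybe ℕ → Maybe ℕ → Set
Differ a b = ∀ c → a ≡ just c → b ≡ just c → ⊥

InList : Maybe ℕ → ColSet → Set
InList a L = ∀ c → a ≡ just c → c ∈ L

record IsPartialLTotal (G : Graph) (L : ListAssignment G) (φ : PartialCol G) : Set where
  field
    esym     : ∀ u v → Edge G u v → pe φ u v ≡ pe φ v u
    vlist    : ∀ v → InList (pv φ v) (Lv L v)
    elist    : ∀ u v → Edge G u v → InList (pe φ u v) (Le L u v)
    vv       : ∀ u v → Edge G u v → Differ (pv φ u) (pv φ v)
    ee       : ∀ u v w → Edge G u v → Edge G u w → v ≢ w → Differ (pe φ u v) (pe φ u w)
    ve       : ∀ u v → Edge G u v → Differ (pv φ u) (pe φ u v)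

record IsLTotal (G : Graph) (L : ListAssignment G)
                (cv : Vtx G → ℕ) (ce : Vtx G → Vtx G → ℕ) : Set where
  field
    esym  : ∀ u v → Edge G u v → ce u v ≡ ce v u
    vlist : ∀ v → cv v ∈ Lv L v
    elist : ∀ u v → Edge G u v → ce u v ∈ Le L u v
    vv    : ∀ u v → Edge G u v → cv u ≢ cv v
    ee    : ∀ u v w → Edge G u v → Edge G u w → v ≢ w → ce u v ≢ ce u w
    ve    : ∀ u v → Edge G u v → cv u ≢ ce u v

Extends : (G : Graph) → PartialCol G → (Vtx G → ℕ) → (Vtx G → Vtx G → ℕ) → Set
Extends G φ cv ce =
  (∀ v c → pv φ v ≡ just c → cv v ≡ c) ×
  (∀ u v c → Edge G u v → pe φ u v ≡ just c → ce u v ≡ c)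

maybeList : Maybe ℕ → List ℕ
maybeList nothing  = []
maybeList (just c) = c ∷ []

usedV : (G : Graph) → PartialCol G → Vtx G → List ℕ
usedV G φ v = concatMap (λ w → if adj G v w then maybeList (pv φ w) ++ maybeList (pe φ v w) else [])
                        (allFin (n G))

usedE : (G : Graph) → PartialCol G → Vtx G → Vtx G → List ℕ
usedE G φ u v =
  maybeList (pv φ u) ++ maybeList (pv φ v) ++
  concatMap (λ w → (if adj G u w ∧ not ⌊ w ≟F v ⌋ then maybeList (pe φ u w) else []) ++
                   (if adj G v w ∧ not ⌊ w ≟F u ⌋ then maybeList (pe φ v w) else []))
            (allFin (n G))

LavV : (G : Graph) → ListAssignment G → PartialCol G → Vtx G → ColSet
LavV G L φ v = filter (λ c → ¬? (c ∈? usedV G φ v)) (Lv L v)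

LavE : (G : Graph) → ListAssignment G → PartialCol G → Vtx G → Vtx G → ColSet
LavE G L φ u v = filter (λ c → ¬? (c ∈? usedE G φ u v)) (Le L u v)

SamePair : {A : Set} → A → A → A → A → Set
SamePair a b u v = (u ≡ a × v ≡ b) ⊎ (u ≡ b × v ≡ a)

-- The ten uncoloured elements are the vertices and edges of the K₄ on u₁ … u₄, and the
-- available lists already exclude every colour φ places next to them, so it suffices to
-- list-colour this K₄. Colour the triangle u₁, u₃, u₁u₃ with three distinct colours
-- (possible unless its three lists are the same 2-set) and delete them from the other
-- lists: u₂, u₄ keep at least 4 colours, the chord u₂u₄ keeps 6 and the 4-cycle
-- u₁u₂u₃u₄ keeps 2 on each edge. Colouring the cycle, then u₂ and u₄, greedily leaves the
-- chord with six coloured neighbours, so it only needs one saving: a seventh colour, a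
-- repeated colour among its neighbours, or a neighbour colour outside its list. When no
-- saving is possible the lists are "stuck", and a count inside the six chord colours shows
-- that at most one triangle colouring can be stuck, while there are always two of them.

module Submission where

open import Data.Nat using (ℕ; suc; _+_; _≤_; _<_; z≤n; s≤s)
open import Data.Nat.Properties
  using (≤-trans; <-≤-trans; ≤⇒≯; ≤-antisym; _≤?_; ≰⇒>; ≤-pred; +-mono-≤; +-monoˡ-≤; +-cancelˡ-≤; +-cancelʳ-≤)
  renaming (_≟_ to _≟ℕ_)
open import Data.List using (List; []; _∷_; _++_; length; filter; deduplicate; concatMap; allFin)
open import Data.Bool using (T; if_then_else_; _∧_; not)
open import Data.Bool.Properties using (T-≡)
open import Data.Fin using (Fin)
open import Data.Fin.Patterns using (0F; 1F; 2F; 3F)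
open import Data.Fin.Properties using () renaming (_≟_ to _≟F_; any? to any-Fin?)
open import Data.Maybe using (just; nothing; fromMaybe)
open import Data.List.Properties using (length-++; filter-notAll; filter-all)
open import Data.List.Membership.Propositional using (_∈_; _∉_; find; lose)
open import Data.List.Membership.Propositional.Properties
  using (∈-filter⁺; ∈-filter⁻; ∈-++⁺ˡ; ∈-++⁺ʳ; ∈-++⁻; ∈-deduplicate⁺; ∈-deduplicate⁻; ∈-concatMap⁺; ∈-allFin)
open import Data.List.Relation.Binary.Permutation.Propositional using (_↭_; ↭-trans)
open import Data.List.Relation.Binary.Permutation.Propositional.Properties
  using (Any-resp-↭; shifts; ++-comm) renaming (++⁺ to ++⁺-↭; ++⁺ˡ to ++⁺ˡ-↭)
open import Data.List.Membership.DecPropositional _≟ℕ_ using (_∈?_)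
open import Data.List.Relation.Binary.Subset.Propositional using (_⊆_)
open import Data.List.Relation.Binary.Disjoint.Propositional using (Disjoint)
open import Data.List.Relation.Binary.Disjoint.Propositional.Properties
  using () renaming (sym to Disjoint-sym)
open import Data.List.Relation.Unary.Any using (here; there; any?)
import Data.List.Relation.Unary.Any as Any
open import Data.List.Relation.Unary.All using (All; []; _∷_; all?)
import Data.List.Relation.Unary.All as All
open import Data.List.Relation.Unary.AllPairs using (_∷_)
open import Data.List.Relation.Unary.Unique.Propositional using (Unique)
open import Data.List.Relation.Unary.Unique.Propositional.Properties using (++⁺)
open import Data.List.Relation.Unary.Unique.DecPropositional.Properties _≟ℕ_ using (deduplicate-!)
open import Data.Product using (_×_; _,_; proj₁; proj₂; ∃₂; ∃-syntax)
open import Data.Sum using (_⊎_; inj₁; inj₂; [_,_]′)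
open import Relation.Nullary using (¬_; ¬?; yes; no; contradiction)
open import Relation.Nullary.Decidable using (⌊_⌋; decidable-stable)
open import Data.Empty using (⊥; ⊥-elim)
open import Relation.Binary.PropositionalEquality
  using (_≡_; _≢_; refl; sym; trans; cong; cong₂; subst; ≢-sym)
open import Function using (_⇔_; mk⇔; Equivalence; _$_)

open import Defs hiding (sym)

-- Colour lists as finite sets

dedup : List ℕ → List ℕ
dedup = deduplicate _≟ℕ_

∈-dedup⁻ : ∀ {z} xs → z ∈ dedup xs → z ∈ xs
∈-dedup⁻ xs = ∈-deduplicate⁻ {R = _≡_} _≟ℕ_ xs

-- LavV and LavE are literally Lv ∖ usedV and Le ∖ usedE, so the ∖ lemmas apply to them.
infixl 5 _∖_

_∖_ : List ℕ → List ℕ → List ℕ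
xs ∖ ks = filter (λ c → ¬? (c ∈? ks)) xs

∈-∖⁺ : ∀ {z xs} ks → z ∈ xs → z ∉ ks → z ∈ xs ∖ ks
∈-∖⁺ ks = ∈-filter⁺ (λ c → ¬? (c ∈? ks))

∈-∖⁻ : ∀ {z} xs ks → z ∈ xs ∖ ks → z ∈ xs × z ∉ ks
∈-∖⁻ xs ks = ∈-filter⁻ (λ c → ¬? (c ∈? ks))

Unique⇒length≤ : ∀ {xs} ys → Unique xs → xs ⊆ ys → length xs ≤ length ys
Unique⇒length≤ {[]}     ys _          _    = z≤n
Unique⇒length≤ {x ∷ xs} ys (x∉xs ∷ u) x∷xs⊆ys =
  <-≤-trans (s≤s (Unique⇒length≤ ys′ u xs⊆ys′))
            (filter-notAll (λ z → ¬? (x ≟ℕ z)) ys (Any.map (λ x≡ x≢ → x≢ x≡) (x∷xs⊆ys (here refl))))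
  where
  ys′ : List ℕ
  ys′ = filter (λ z → ¬? (x ≟ℕ z)) ys
  xs⊆ys′ : xs ⊆ ys′
  xs⊆ys′ z∈ = ∈-filter⁺ (λ z → ¬? (x ≟ℕ z)) (x∷xs⊆ys (there z∈)) (All.lookup x∉xs z∈)

Unique⇒length≤card : ∀ {xs} ys → Unique xs → xs ⊆ ys → length xs ≤ card ys
Unique⇒length≤card ys u xs⊆ys = Unique⇒length≤ (dedup ys) u (λ z∈ → ∈-deduplicate⁺ _≟ℕ_ (xs⊆ys z∈))

card-mono : ∀ {xs ys} → xs ⊆ ys → card xs ≤ card ys
card-mono {xs} {ys} xs⊆ys = Unique⇒length≤card ys (deduplicate-! xs) (λ z∈ → xs⊆ys (∈-dedup⁻ xs z∈))

card-∷ : ∀ {z} xs → z ∉ xs → card (z ∷ xs) ≡ suc (card xs)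
card-∷ {z} xs z∉xs = cong (λ ys → suc (length ys))
  (filter-all (λ y → ¬? (z ≟ℕ y)) (All.tabulate λ y∈ z≡y → z∉xs (subst (_∈ xs) (sym z≡y) (∈-dedup⁻ xs y∈))))

card-∖ : ∀ xs ks → card xs ≤ card (xs ∖ ks) + length ks
card-∖ xs ks = subst (card xs ≤_) (length-++ (dedup (xs ∖ ks)))
  (Unique⇒length≤ (dedup (xs ∖ ks) ++ ks) (deduplicate-! xs) covered)
  where
  covered : dedup xs ⊆ dedup (xs ∖ ks) ++ ks
  covered {z} z∈ with z ∈? ks
  ... | yes z∈ks = ∈-++⁺ʳ (dedup (xs ∖ ks)) z∈ks
  ... | no  z∉ks = ∈-++⁺ˡ (∈-deduplicate⁺ _≟ℕ_ (∈-∖⁺ ks (∈-dedup⁻ xs z∈) z∉ks))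

card-disjoint : ∀ {xs ys zs} → Disjoint xs ys → xs ⊆ zs → ys ⊆ zs → card xs + card ys ≤ card zs
card-disjoint {xs} {ys} {zs} xs#ys xs⊆zs ys⊆zs = subst (_≤ card zs) (length-++ (dedup xs))
  (Unique⇒length≤card zs
    (++⁺ (deduplicate-! xs) (deduplicate-! ys) λ (p , q) → xs#ys (∈-dedup⁻ xs p , ∈-dedup⁻ ys q))
    covered)
  where
  covered : dedup xs ++ dedup ys ⊆ zs
  covered z∈ with ∈-++⁻ (dedup xs) z∈
  ... | inj₁ p = xs⊆zs (∈-dedup⁻ xs p)
  ... | inj₂ q = ys⊆zs (∈-dedup⁻ ys q)

FreshIn : List ℕ → List ℕ → Set
FreshIn xs ks = ∃[ c ] c ∈ xs × All (c ≢_) ks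

fresh : ∀ xs ks → length ks < card xs → FreshIn xs ks
fresh xs ks ks<xs with any? (λ c → all? (λ k → ¬? (c ≟ℕ k)) ks) xs
... | yes p = find p
... | no ¬p = contradiction ks<xs (≤⇒≯ (Unique⇒length≤ ks (deduplicate-! xs) covered))
  where
  covered : dedup xs ⊆ ks
  covered {z} z∈ with z ∈? ks
  ... | yes z∈ks = z∈ks
  ... | no  z∉ks = contradiction
    (lose (∈-dedup⁻ xs z∈) (All.tabulate λ k∈ z≡k → z∉ks (subst (_∈ ks) (sym z≡k) k∈))) ¬p

∈-∉⇒≢ : ∀ {x y} {xs : List ℕ} → x ∈ xs → y ∉ xs → x ≢ y
∈-∉⇒≢ x∈ y∉ refl = y∉ x∈

outside-or-⊆ : ∀ xs ys → (∃[ z ] z ∈ xs × z ∉ ys) ⊎ xs ⊆ ys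
outside-or-⊆ xs ys with any? (λ z → ¬? (z ∈? ys)) xs
... | yes p = inj₁ (find p)
... | no ¬p = inj₂ λ {z} z∈xs → decidable-stable (z ∈? ys) λ z∉ys → ¬p (lose z∈xs z∉ys)

common-or-disjoint : ∀ xs ys → (∃[ z ] z ∈ xs × z ∈ ys) ⊎ Disjoint xs ys
common-or-disjoint xs ys with any? (_∈? ys) xs
... | yes p = inj₁ (find p)
... | no ¬p = inj₂ λ (z∈xs , z∈ys) → ¬p (lose z∈xs z∈ys)

∈-∖-pair⁺ : ∀ {z a b xs} → z ∈ xs → z ≢ a → z ≢ b → z ∈ xs ∖ (a ∷ b ∷ [])
∈-∖-pair⁺ z∈ z≢a z≢b = ∈-∖⁺ (_ ∷ _ ∷ []) z∈ λ { (here z≡a) → z≢a z≡a ; (there (here z≡b)) → z≢b z≡b }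

∈-∖-pair⁻ : ∀ {z a b} xs → z ∈ xs ∖ (a ∷ b ∷ []) → z ∈ xs × z ≢ a × z ≢ b
∈-∖-pair⁻ xs z∈ with ∈-∖⁻ xs _ z∈
... | z∈xs , z∉ab = z∈xs , (λ z≡a → z∉ab (here z≡a)) , (λ z≡b → z∉ab (there (here z≡b)))

∉-∖-pairˡ : ∀ {a b} xs → a ∉ xs ∖ (a ∷ b ∷ [])
∉-∖-pairˡ xs a∈ = proj₁ (proj₂ (∈-∖-pair⁻ xs a∈)) refl

∉-∖-pairʳ : ∀ {a b} xs → b ∉ xs ∖ (a ∷ b ∷ [])
∉-∖-pairʳ xs b∈ = proj₂ (proj₂ (∈-∖-pair⁻ xs b∈)) refl

card-∖-pair : ∀ {n a b} xs → n + 2 ≤ card xs → n ≤ card (xs ∖ (a ∷ b ∷ []))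
card-∖-pair {n} xs n+2≤xs = +-cancelʳ-≤ 2 n _ (≤-trans n+2≤xs (card-∖ xs _))

∖-absent-⊆ : ∀ {k} xs ks ks′ → k ∉ xs → (∀ {z} → z ∈ ks′ → z ≡ k ⊎ z ∈ ks) → xs ∖ ks ⊆ xs ∖ ks′
∖-absent-⊆ xs ks ks′ k∉xs covers {z} z∈ with ∈-∖⁻ xs ks z∈
... | z∈xs , z∉ks = ∈-∖⁺ ks′ z∈xs λ z∈ks′ → [ (λ { refl → k∉xs z∈xs }) , z∉ks ]′ (covers z∈ks′)

removed-present : ∀ {a b} xs → 4 ≤ card xs → card (xs ∖ (a ∷ b ∷ [])) ≤ 2 → a ∈ xs × b ∈ xs
removed-present {a} {b} xs 4≤xs rest≤2 =
  ( present a b (λ { (here refl) → inj₁ refl ; (there b∈) → inj₂ b∈ })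
  , present b a (λ { (here refl) → inj₂ (here refl) ; (there (here refl)) → inj₁ refl }) )
  where
  present : ∀ k k′ → (∀ {z} → z ∈ a ∷ b ∷ [] → z ≡ k ⊎ z ∈ k′ ∷ []) → k ∈ xs
  present k k′ covers with k ∈? xs
  ... | yes k∈xs = k∈xs
  ... | no  k∉xs = contradiction
    (≤-trans 4≤xs (≤-trans (card-∖ xs (k′ ∷ []))
      (+-monoˡ-≤ 1 (≤-trans (card-mono (∖-absent-⊆ xs (k′ ∷ []) (a ∷ b ∷ []) k∉xs covers)) rest≤2))))
    λ { (s≤s (s≤s (s≤s ()))) }

disjoint-beside-4-in-6⇒≤2 : ∀ {M N Y} → 4 ≤ card M → Disjoint M N → M ⊆ Y → N ⊆ Y → card Y ≤ 6 →
  card N ≤ 2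
disjoint-beside-4-in-6⇒≤2 4≤M M#N M⊆Y N⊆Y Y≤6 =
  +-cancelˡ-≤ 4 _ 2 (≤-trans (+-monoˡ-≤ _ 4≤M) (≤-trans (card-disjoint M#N M⊆Y N⊆Y) Y≤6))

disjoint-4+2+1-in-6⇒⊥ : ∀ {M N Y z} → 4 ≤ card M → 2 ≤ card N → Disjoint M N →
  z ∉ M → z ∉ N → M ⊆ Y → N ⊆ Y → z ∈ Y → ¬ card Y ≤ 6
disjoint-4+2+1-in-6⇒⊥ {M} {N} {Y} {z} 4≤M 2≤N M#N z∉M z∉N M⊆Y N⊆Y z∈Y Y≤6 = 7≰6
  (≤-trans (+-mono-≤ 4≤M (subst (3 ≤_) (sym (card-∷ N z∉N)) (s≤s 2≤N)))
    (≤-trans (card-disjoint M#z∷N M⊆Y z∷N⊆Y) Y≤6))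
  where
  M#z∷N : Disjoint M (z ∷ N)
  M#z∷N (p , here refl) = z∉M p
  M#z∷N (p , there q)   = M#N (p , q)
  z∷N⊆Y : z ∷ N ⊆ Y
  z∷N⊆Y (here refl) = z∈Y
  z∷N⊆Y (there q)   = N⊆Y q
  7≰6 : ¬ 7 ≤ 6
  7≰6 (s≤s (s≤s (s≤s (s≤s (s≤s (s≤s ()))))))

-- Transversals of three lists

record Transversal (P Q R : List ℕ) : Set where
  field
    p q r : ℕ
    p∈ : p ∈ P
    q∈ : q ∈ Q
    r∈ : r ∈ R
    p≢q : p ≢ q
    p≢r : p ≢ r
    q≢r : q ≢ r

  triple : ℕ × ℕ × ℕ
  triple = p , q , r

open Transversal

rotate : ∀ {P Q R} → Transversal Q R P → Transversal P Q R
rotate T = record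
  { p = r T ; q = p T ; r = q T ; p∈ = r∈ T ; q∈ = p∈ T ; r∈ = q∈ T
  ; p≢q = ≢-sym (p≢r T) ; p≢r = ≢-sym (q≢r T) ; q≢r = p≢q T }

transversal-escaping : ∀ {α P Q R} → α ∈ P → α ∉ Q → 2 ≤ card Q → 2 ≤ card R → Transversal P Q R
transversal-escaping {α} {Q = Q} {R} α∈P α∉Q 2≤Q 2≤R with fresh R (α ∷ []) 2≤R
... | r , r∈R , r≢α ∷ [] with fresh Q (r ∷ []) 2≤Q
... | q , q∈Q , q≢r ∷ [] = record
  { p = α ; q = q ; r = r ; p∈ = α∈P ; q∈ = q∈Q ; r∈ = r∈R
  ; p≢q = ≢-sym (∈-∉⇒≢ q∈Q α∉Q) ; p≢r = ≢-sym r≢α ; q≢r = q≢r }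

transversal : ∀ {P Q R} → 2 ≤ card P → 2 ≤ card Q → 2 ≤ card R →
  (card P ≡ 2 → card Q ≡ 2 → card R ≡ 2 → ¬ ((P ≈ₛ Q) × (Q ≈ₛ R))) → Transversal P Q R
transversal {P} {Q} {R} 2≤P 2≤Q 2≤R not-all-same with outside-or-⊆ P Q
... | inj₁ (_ , α∈P , α∉Q) = transversal-escaping α∈P α∉Q 2≤Q 2≤R
... | inj₂ P⊆Q with outside-or-⊆ Q R
... | inj₁ (_ , α∈Q , α∉R) = rotate (transversal-escaping α∈Q α∉R 2≤R 2≤P)
... | inj₂ Q⊆R with outside-or-⊆ R P
... | inj₁ (_ , α∈R , α∉P) = rotate (rotate (transversal-escaping α∈R α∉P 2≤P 2≤Q))
... | inj₂ R⊆P with 3 ≤? card P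
... | yes 3≤P = three-in-P (fresh P [] (≤-trans (s≤s z≤n) 3≤P))
  where
  three-in-P : FreshIn P [] → Transversal P Q R
  three-in-P (x , x∈ , []) with fresh P (x ∷ []) 2≤P
  ... | y , y∈ , y≢x ∷ [] with fresh P (x ∷ y ∷ []) 3≤P
  ... | z , z∈ , z≢x ∷ z≢y ∷ [] = record
    { p = x ; q = y ; r = z ; p∈ = x∈ ; q∈ = P⊆Q y∈ ; r∈ = Q⊆R (P⊆Q z∈)
    ; p≢q = ≢-sym y≢x ; p≢r = ≢-sym z≢x ; q≢r = ≢-sym z≢y }
... | no 3≰P = contradiction (P≈Q , Q≈R) (not-all-same |P|≡2 |Q|≡2 |R|≡2)
  where
  P≈Q : P ≈ₛ Q
  P≈Q _ = mk⇔ P⊆Q (λ z∈ → R⊆P (Q⊆R z∈))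
  Q≈R : Q ≈ₛ R
  Q≈R _ = mk⇔ Q⊆R (λ z∈ → P⊆Q (R⊆P z∈))
  |P|≤2 : card P ≤ 2
  |P|≤2 = ≤-pred (≰⇒> 3≰P)
  |P|≡2 : card P ≡ 2
  |P|≡2 = ≤-antisym |P|≤2 2≤P
  |Q|≡2 : card Q ≡ 2
  |Q|≡2 = ≤-antisym (≤-trans (card-mono (λ z∈ → R⊆P (Q⊆R z∈))) |P|≤2) 2≤Q
  |R|≡2 : card R ≡ 2
  |R|≡2 = ≤-antisym (≤-trans (card-mono R⊆P) |P|≤2) 2≤R

avoids-or-meets : ∀ {x a b} {xs : List ℕ} → x ∈ xs → (x ≢ a × x ≢ b) ⊎ (a ∈ xs ⊎ b ∈ xs)
avoids-or-meets {x} {a} {b} x∈ with x ≟ℕ a | x ≟ℕ b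
... | yes refl | _        = inj₂ (inj₁ x∈)
... | no _     | yes refl = inj₂ (inj₂ x∈)
... | no x≢a   | no x≢b   = inj₁ (x≢a , x≢b)

module _ {P Q R : List ℕ} (T : Transversal P Q R) where

  swap-pq : q T ∈ P → p T ∈ Q → ∃[ T′ ] triple T′ ≢ triple T
  swap-pq q∈P p∈Q = record
    { p = q T ; q = p T ; r = r T ; p∈ = q∈P ; q∈ = p∈Q ; r∈ = r∈ T
    ; p≢q = ≢-sym (p≢q T) ; p≢r = q≢r T ; q≢r = p≢r T }
    , λ eq → p≢q T (sym (cong proj₁ eq))

  swap-pr : r T ∈ P → p T ∈ R → ∃[ T′ ] triple T′ ≢ triple T
  swap-pr r∈P p∈R = record
    { p = r T ; q = q T ; r = p T ; p∈ = r∈P ; q∈ = q∈ T ; r∈ = p∈R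
    ; p≢q = ≢-sym (q≢r T) ; p≢r = ≢-sym (p≢r T) ; q≢r = ≢-sym (p≢q T) }
    , λ eq → p≢r T (sym (cong proj₁ eq))

  swap-qr : r T ∈ Q → q T ∈ R → ∃[ T′ ] triple T′ ≢ triple T
  swap-qr r∈Q q∈R = record
    { p = p T ; q = r T ; r = q T ; p∈ = p∈ T ; q∈ = r∈Q ; r∈ = q∈R
    ; p≢q = p≢r T ; p≢r = p≢q T ; q≢r = ≢-sym (q≢r T) }
    , λ eq → q≢r T (sym (cong (λ t → proj₁ (proj₂ t)) eq))

  cycle-qrp : q T ∈ P → r T ∈ Q → p T ∈ R → ∃[ T′ ] triple T′ ≢ triple T
  cycle-qrp q∈P r∈Q p∈R = record
    { p = q T ; q = r T ; r = p T ; p∈ = q∈P ; q∈ = r∈Q ; r∈ = p∈R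
    ; p≢q = q≢r T ; p≢r = ≢-sym (p≢q T) ; q≢r = ≢-sym (p≢r T) }
    , λ eq → p≢q T (sym (cong proj₁ eq))

  cycle-rpq : r T ∈ P → p T ∈ Q → q T ∈ R → ∃[ T′ ] triple T′ ≢ triple T
  cycle-rpq r∈P p∈Q q∈R = record
    { p = r T ; q = p T ; r = q T ; p∈ = r∈P ; q∈ = p∈Q ; r∈ = q∈R
    ; p≢q = ≢-sym (p≢r T) ; p≢r = ≢-sym (q≢r T) ; q≢r = p≢q T }
    , λ eq → p≢r T (sym (cong proj₁ eq))

-- Each list has a second colour; if none of them can simply replace the transversal's
-- colour in its slot, every slot's second colour is another slot's colour, and following
-- these pointers gives a transposition or a 3-cycle of the transversal.
another-transversal : ∀ {P Q R} → 2 ≤ card P → 2 ≤ card Q → 2 ≤ card R →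
  (T : Transversal P Q R) → ∃[ T′ ] triple T′ ≢ triple T
another-transversal {P} {Q} {R} 2≤P 2≤Q 2≤R T
  with fresh P (p T ∷ []) 2≤P | fresh Q (q T ∷ []) 2≤Q | fresh R (r T ∷ []) 2≤R
... | p′ , p′∈ , p′≢p ∷ [] | q′ , q′∈ , q′≢q ∷ [] | r′ , r′∈ , r′≢r ∷ []
  with avoids-or-meets {a = q T} {r T} p′∈ | avoids-or-meets {a = p T} {r T} q′∈ | avoids-or-meets {a = p T} {q T} r′∈
... | inj₁ (p′≢q , p′≢r) | _ | _ =
  record T { p = p′ ; p∈ = p′∈ ; p≢q = p′≢q ; p≢r = p′≢r } , λ eq → p′≢p (cong proj₁ eq)
... | inj₂ _ | inj₁ (q′≢p , q′≢r) | _ =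
  record T { q = q′ ; q∈ = q′∈ ; p≢q = ≢-sym q′≢p ; q≢r = q′≢r } , λ eq → q′≢q (cong (λ t → proj₁ (proj₂ t)) eq)
... | inj₂ _ | inj₂ _ | inj₁ (r′≢p , r′≢q) =
  record T { r = r′ ; r∈ = r′∈ ; p≢r = ≢-sym r′≢p ; q≢r = ≢-sym r′≢q } , λ eq → r′≢r (cong (λ t → proj₂ (proj₂ t)) eq)
... | inj₂ (inj₁ q∈P) | inj₂ (inj₁ p∈Q) | inj₂ _          = swap-pq T q∈P p∈Q
... | inj₂ (inj₁ q∈P) | inj₂ (inj₂ r∈Q) | inj₂ (inj₁ p∈R) = cycle-qrp T q∈P r∈Q p∈R
... | inj₂ (inj₁ _)   | inj₂ (inj₂ r∈Q) | inj₂ (inj₂ q∈R) = swap-qr T r∈Q q∈R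
... | inj₂ (inj₂ r∈P) | inj₂ (inj₁ _)   | inj₂ (inj₁ p∈R) = swap-pr T r∈P p∈R
... | inj₂ (inj₂ r∈P) | inj₂ (inj₁ p∈Q) | inj₂ (inj₂ q∈R) = cycle-rpq T r∈P p∈Q q∈R
... | inj₂ (inj₂ r∈P) | inj₂ (inj₂ _)   | inj₂ (inj₁ p∈R) = swap-pr T r∈P p∈R
... | inj₂ (inj₂ _)   | inj₂ (inj₂ r∈Q) | inj₂ (inj₂ q∈R) = swap-qr T r∈Q q∈R

-- List colourings of a 4-cycle

record CycleColouring (L₁ L₂ L₃ L₄ : List ℕ) : Set where
  field
    x₁ x₂ x₃ x₄ : ℕ
    x₁∈ : x₁ ∈ L₁
    x₂∈ : x₂ ∈ L₂
    x₃∈ : x₃ ∈ L₃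
    x₄∈ : x₄ ∈ L₄
    x₁≢x₂ : x₁ ≢ x₂
    x₂≢x₃ : x₂ ≢ x₃
    x₃≢x₄ : x₃ ≢ x₄
    x₄≢x₁ : x₄ ≢ x₁

open CycleColouring

rotate-cycle : ∀ {L₁ L₂ L₃ L₄} → CycleColouring L₂ L₃ L₄ L₁ → CycleColouring L₁ L₂ L₃ L₄
rotate-cycle C = record
  { x₁ = x₄ C ; x₂ = x₁ C ; x₃ = x₂ C ; x₄ = x₃ C
  ; x₁∈ = x₄∈ C ; x₂∈ = x₁∈ C ; x₃∈ = x₂∈ C ; x₄∈ = x₃∈ C
  ; x₁≢x₂ = x₄≢x₁ C ; x₂≢x₃ = x₁≢x₂ C ; x₃≢x₄ = x₂≢x₃ C ; x₄≢x₁ = x₃≢x₄ C }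

reflect-cycle : ∀ {L₁ L₂ L₃ L₄} → CycleColouring L₁ L₄ L₃ L₂ → CycleColouring L₁ L₂ L₃ L₄
reflect-cycle C = record
  { x₁ = x₁ C ; x₂ = x₄ C ; x₃ = x₃ C ; x₄ = x₂ C
  ; x₁∈ = x₁∈ C ; x₂∈ = x₄∈ C ; x₃∈ = x₃∈ C ; x₄∈ = x₂∈ C
  ; x₁≢x₂ = ≢-sym (x₄≢x₁ C) ; x₂≢x₃ = ≢-sym (x₃≢x₄ C)
  ; x₃≢x₄ = ≢-sym (x₂≢x₃ C) ; x₄≢x₁ = ≢-sym (x₁≢x₂ C) }

cycle-from : ∀ {L₁ L₂ L₃ L₄ α} → 2 ≤ card L₂ → 2 ≤ card L₃ → 2 ≤ card L₄ →
  α ∈ L₁ → α ∉ L₂ → ∃[ C ] x₁ {L₁} {L₂} {L₃} {L₄} C ≡ α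
cycle-from {L₂ = L₂} {L₃} {L₄} {α} 2≤L₂ 2≤L₃ 2≤L₄ α∈ α∉L₂ with fresh L₄ (α ∷ []) 2≤L₄
... | s , s∈ , s≢α ∷ [] with fresh L₃ (s ∷ []) 2≤L₃
... | r , r∈ , r≢s ∷ [] with fresh L₂ (r ∷ []) 2≤L₂
... | q , q∈ , q≢r ∷ [] = record
  { x₁ = α ; x₂ = q ; x₃ = r ; x₄ = s ; x₁∈ = α∈ ; x₂∈ = q∈ ; x₃∈ = r∈ ; x₄∈ = s∈
  ; x₁≢x₂ = ≢-sym (∈-∉⇒≢ q∈ α∉L₂) ; x₂≢x₃ = q≢r ; x₃≢x₄ = r≢s ; x₄≢x₁ = s≢α } , refl

cycle-through : ∀ {L₁ L₂ L₃ L₄ α} → 2 ≤ card L₂ → 2 ≤ card L₃ → 2 ≤ card L₄ →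
  α ∈ L₁ → Disjoint L₂ L₄ → ∃[ C ] x₁ {L₁} {L₂} {L₃} {L₄} C ≡ α
cycle-through {L₄ = L₄} {α} 2≤L₂ 2≤L₃ 2≤L₄ α∈ L₂#L₄ with α ∈? L₄
... | yes α∈L₄ = cycle-from 2≤L₂ 2≤L₃ 2≤L₄ α∈ (λ α∈L₂ → L₂#L₄ (α∈L₂ , α∈L₄))
... | no  α∉L₄ with cycle-from 2≤L₄ 2≤L₃ 2≤L₂ α∈ α∉L₄
...   | C , x₁≡α = reflect-cycle C , x₁≡α

-- Either some list has a colour missing from the next one, and the greedy colouring
-- started there closes up, or L₁ ⊆ L₂ ⊆ L₃ ⊆ L₄ ⊆ L₁ and two colours alternate.
cycle-colouring : ∀ {L₁ L₂ L₃ L₄} → 2 ≤ card L₁ → 2 ≤ card L₂ → 2 ≤ card L₃ → 2 ≤ card L₄ →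
  CycleColouring L₁ L₂ L₃ L₄
cycle-colouring {L₁} {L₂} {L₃} {L₄} 2≤L₁ 2≤L₂ 2≤L₃ 2≤L₄ with outside-or-⊆ L₁ L₂
... | inj₁ (_ , α∈ , α∉) = proj₁ (cycle-from 2≤L₂ 2≤L₃ 2≤L₄ α∈ α∉)
... | inj₂ L₁⊆L₂ with outside-or-⊆ L₂ L₃
... | inj₁ (_ , α∈ , α∉) = rotate-cycle (proj₁ (cycle-from 2≤L₃ 2≤L₄ 2≤L₁ α∈ α∉))
... | inj₂ L₂⊆L₃ with outside-or-⊆ L₃ L₄
... | inj₁ (_ , α∈ , α∉) = rotate-cycle (rotate-cycle (proj₁ (cycle-from 2≤L₄ 2≤L₁ 2≤L₂ α∈ α∉)))
... | inj₂ L₃⊆L₄ with outside-or-⊆ L₄ L₁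
... | inj₁ (_ , α∈ , α∉) = rotate-cycle (rotate-cycle (rotate-cycle (proj₁ (cycle-from 2≤L₁ 2≤L₂ 2≤L₃ α∈ α∉))))
... | inj₂ _ with fresh L₁ [] (≤-trans (s≤s z≤n) 2≤L₁)
... | a , a∈ , [] with fresh L₁ (a ∷ []) 2≤L₁
... | b , b∈ , b≢a ∷ [] = record
  { x₁ = a ; x₂ = b ; x₃ = a ; x₄ = b
  ; x₁∈ = a∈ ; x₂∈ = L₁⊆L₂ b∈ ; x₃∈ = L₂⊆L₃ (L₁⊆L₂ a∈) ; x₄∈ = L₃⊆L₄ (L₂⊆L₃ (L₁⊆L₂ b∈))
  ; x₁≢x₂ = ≢-sym b≢a ; x₂≢x₃ = b≢a ; x₃≢x₄ = ≢-sym b≢a ; x₄≢x₁ = b≢a }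

-- The residual problem

-- What is left on u₂, u₄, the chord u₂u₄ and the rim u₁u₂u₃u₄ once u₁, u₃ and u₁u₃ are
-- coloured; Rᵢ is the list of uᵢ and Rᵢⱼ that of uᵢuⱼ.
record Residual : Set where
  field
    R₂ R₄ R₂₄ R₁₂ R₂₃ R₃₄ R₁₄ : List ℕ
    4≤R₂  : 4 ≤ card R₂
    4≤R₄  : 4 ≤ card R₄
    6≤R₂₄ : 6 ≤ card R₂₄
    2≤R₁₂ : 2 ≤ card R₁₂
    2≤R₂₃ : 2 ≤ card R₂₃
    2≤R₃₄ : 2 ≤ card R₃₄
    2≤R₁₄ : 2 ≤ card R₁₄

open Residual

record ResidualColouring (R : Residual) : Set where
  field
    c₂ c₄ c₂₄ c₁₂ c₂₃ c₃₄ c₁₄ : ℕ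
    c₂∈  : c₂ ∈ R₂ R
    c₄∈  : c₄ ∈ R₄ R
    c₂₄∈ : c₂₄ ∈ R₂₄ R
    c₁₂∈ : c₁₂ ∈ R₁₂ R
    c₂₃∈ : c₂₃ ∈ R₂₃ R
    c₃₄∈ : c₃₄ ∈ R₃₄ R
    c₁₄∈ : c₁₄ ∈ R₁₄ R
    c₂≢c₄   : c₂ ≢ c₄
    c₂≢c₂₄  : c₂ ≢ c₂₄
    c₄≢c₂₄  : c₄ ≢ c₂₄
    c₂≢c₁₂  : c₂ ≢ c₁₂
    c₂≢c₂₃  : c₂ ≢ c₂₃
    c₄≢c₃₄  : c₄ ≢ c₃₄
    c₄≢c₁₄  : c₄ ≢ c₁₄
    c₂₄≢c₁₂ : c₂₄ ≢ c₁₂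
    c₂₄≢c₂₃ : c₂₄ ≢ c₂₃
    c₂₄≢c₃₄ : c₂₄ ≢ c₃₄
    c₂₄≢c₁₄ : c₂₄ ≢ c₁₄
    c₁₂≢c₂₃ : c₁₂ ≢ c₂₃
    c₂₃≢c₃₄ : c₂₃ ≢ c₃₄
    c₃₄≢c₁₄ : c₃₄ ≢ c₁₄
    c₁₄≢c₁₂ : c₁₄ ≢ c₁₂

swap₁₃ : Residual → Residual
swap₁₃ R = record R
  { R₁₂ = R₂₃ R ; R₂₃ = R₁₂ R ; R₃₄ = R₁₄ R ; R₁₄ = R₃₄ R
  ; 2≤R₁₂ = 2≤R₂₃ R ; 2≤R₂₃ = 2≤R₁₂ R ; 2≤R₃₄ = 2≤R₁₄ R ; 2≤R₁₄ = 2≤R₃₄ R }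

swap₂₄ : Residual → Residual
swap₂₄ R = record R
  { R₂ = R₄ R ; R₄ = R₂ R ; R₁₂ = R₁₄ R ; R₂₃ = R₃₄ R ; R₃₄ = R₂₃ R ; R₁₄ = R₁₂ R
  ; 4≤R₂ = 4≤R₄ R ; 4≤R₄ = 4≤R₂ R
  ; 2≤R₁₂ = 2≤R₁₄ R ; 2≤R₂₃ = 2≤R₃₄ R ; 2≤R₃₄ = 2≤R₂₃ R ; 2≤R₁₄ = 2≤R₁₂ R }

module _ {R : Residual} where
  open ResidualColouring

  unswap₁₃ : ResidualColouring (swap₁₃ R) → ResidualColouring R
  unswap₁₃ S = record
    { c₂ = c₂ S ; c₄ = c₄ S ; c₂₄ = c₂₄ S ; c₁₂ = c₂₃ S ; c₂₃ = c₁₂ S ; c₃₄ = c₁₄ S ; c₁₄ = c₃₄ S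
    ; c₂∈ = c₂∈ S ; c₄∈ = c₄∈ S ; c₂₄∈ = c₂₄∈ S
    ; c₁₂∈ = c₂₃∈ S ; c₂₃∈ = c₁₂∈ S ; c₃₄∈ = c₁₄∈ S ; c₁₄∈ = c₃₄∈ S
    ; c₂≢c₄ = c₂≢c₄ S ; c₂≢c₂₄ = c₂≢c₂₄ S ; c₄≢c₂₄ = c₄≢c₂₄ S
    ; c₂≢c₁₂ = c₂≢c₂₃ S ; c₂≢c₂₃ = c₂≢c₁₂ S ; c₄≢c₃₄ = c₄≢c₁₄ S ; c₄≢c₁₄ = c₄≢c₃₄ S
    ; c₂₄≢c₁₂ = c₂₄≢c₂₃ S ; c₂₄≢c₂₃ = c₂₄≢c₁₂ S ; c₂₄≢c₃₄ = c₂₄≢c₁₄ S ; c₂₄≢c₁₄ = c₂₄≢c₃₄ S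
    ; c₁₂≢c₂₃ = ≢-sym (c₁₂≢c₂₃ S) ; c₂₃≢c₃₄ = ≢-sym (c₁₄≢c₁₂ S)
    ; c₃₄≢c₁₄ = ≢-sym (c₃₄≢c₁₄ S) ; c₁₄≢c₁₂ = ≢-sym (c₂₃≢c₃₄ S) }

  unswap₂₄ : ResidualColouring (swap₂₄ R) → ResidualColouring R
  unswap₂₄ S = record
    { c₂ = c₄ S ; c₄ = c₂ S ; c₂₄ = c₂₄ S ; c₁₂ = c₁₄ S ; c₂₃ = c₃₄ S ; c₃₄ = c₂₃ S ; c₁₄ = c₁₂ S
    ; c₂∈ = c₄∈ S ; c₄∈ = c₂∈ S ; c₂₄∈ = c₂₄∈ S
    ; c₁₂∈ = c₁₄∈ S ; c₂₃∈ = c₃₄∈ S ; c₃₄∈ = c₂₃∈ S ; c₁₄∈ = c₁₂∈ S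
    ; c₂≢c₄ = ≢-sym (c₂≢c₄ S) ; c₂≢c₂₄ = c₄≢c₂₄ S ; c₄≢c₂₄ = c₂≢c₂₄ S
    ; c₂≢c₁₂ = c₄≢c₁₄ S ; c₂≢c₂₃ = c₄≢c₃₄ S ; c₄≢c₃₄ = c₂≢c₂₃ S ; c₄≢c₁₄ = c₂≢c₁₂ S
    ; c₂₄≢c₁₂ = c₂₄≢c₁₄ S ; c₂₄≢c₂₃ = c₂₄≢c₃₄ S ; c₂₄≢c₃₄ = c₂₄≢c₂₃ S ; c₂₄≢c₁₄ = c₂₄≢c₁₂ S
    ; c₁₂≢c₂₃ = ≢-sym (c₃₄≢c₁₄ S) ; c₂₃≢c₃₄ = ≢-sym (c₂₃≢c₃₄ S)
    ; c₃₄≢c₁₄ = ≢-sym (c₁₂≢c₂₃ S) ; c₁₄≢c₁₂ = ≢-sym (c₁₄≢c₁₂ S) }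

Rim : Residual → Set
Rim R = CycleColouring (R₁₂ R) (R₂₃ R) (R₃₄ R) (R₁₄ R)

some-rim : (R : Residual) → Rim R
some-rim R = cycle-colouring (2≤R₁₂ R) (2≤R₂₃ R) (2≤R₃₄ R) (2≤R₁₄ R)

-- Greedily colouring the rim, u₂ and u₄ leaves six coloured neighbours of the chord, so each
-- case below supplies a chord colour by saving one of them.
ChordColour : (R : Residual) → Rim R → ℕ → ℕ → Set
ChordColour R C b d = FreshIn (R₂₄ R) (x₁ C ∷ x₂ C ∷ x₃ C ∷ x₄ C ∷ b ∷ d ∷ [])

complete : (R : Residual) (C : Rim R) {b : ℕ} → b ∈ R₂ R → b ≢ x₁ C → b ≢ x₂ C →
  (∀ d → ChordColour R C b d) → ResidualColouring R
complete R C {b} b∈ b≢x₁ b≢x₂ chord with fresh (R₄ R) (x₃ C ∷ x₄ C ∷ b ∷ []) (4≤R₄ R)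
... | d , d∈ , d≢x₃ ∷ d≢x₄ ∷ d≢b ∷ [] with chord d
... | y , y∈ , y≢x₁ ∷ y≢x₂ ∷ y≢x₃ ∷ y≢x₄ ∷ y≢b ∷ y≢d ∷ [] = record
  { c₂ = b ; c₄ = d ; c₂₄ = y ; c₁₂ = x₁ C ; c₂₃ = x₂ C ; c₃₄ = x₃ C ; c₁₄ = x₄ C
  ; c₂∈ = b∈ ; c₄∈ = d∈ ; c₂₄∈ = y∈ ; c₁₂∈ = x₁∈ C ; c₂₃∈ = x₂∈ C ; c₃₄∈ = x₃∈ C ; c₁₄∈ = x₄∈ C
  ; c₂≢c₄ = ≢-sym d≢b ; c₂≢c₂₄ = ≢-sym y≢b ; c₄≢c₂₄ = ≢-sym y≢d
  ; c₂≢c₁₂ = b≢x₁ ; c₂≢c₂₃ = b≢x₂ ; c₄≢c₃₄ = d≢x₃ ; c₄≢c₁₄ = d≢x₄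
  ; c₂₄≢c₁₂ = y≢x₁ ; c₂₄≢c₂₃ = y≢x₂ ; c₂₄≢c₃₄ = y≢x₃ ; c₂₄≢c₁₄ = y≢x₄
  ; c₁₂≢c₂₃ = x₁≢x₂ C ; c₂₃≢c₃₄ = x₂≢x₃ C ; c₃₄≢c₁₄ = x₃≢x₄ C ; c₁₄≢c₁₂ = x₄≢x₁ C }

complete-greedy : (R : Residual) (C : Rim R) → (∀ b d → ChordColour R C b d) → ResidualColouring R
complete-greedy R C chord with fresh (R₂ R) (x₁ C ∷ x₂ C ∷ []) (≤-trans (s≤s (s≤s (s≤s z≤n))) (4≤R₂ R))
... | b , b∈ , b≢x₁ ∷ b≢x₂ ∷ [] = complete R C b∈ b≢x₁ b≢x₂ (chord b)

colour-if-R₂₄-large : (R : Residual) → 7 ≤ card (R₂₄ R) → ResidualColouring R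
colour-if-R₂₄-large R 7≤R₂₄ = complete-greedy R (some-rim R) λ b d → fresh (R₂₄ R) _ 7≤R₂₄

colour-if-R₁₂∩R₃₄ : (R : Residual) {α : ℕ} → α ∈ R₁₂ R → α ∈ R₃₄ R → ResidualColouring R
colour-if-R₁₂∩R₃₄ R {α} α∈R₁₂ α∈R₃₄
  with fresh (R₂₃ R) (α ∷ []) (2≤R₂₃ R) | fresh (R₁₄ R) (α ∷ []) (2≤R₁₄ R)
... | q , q∈ , q≢α ∷ [] | s , s∈ , s≢α ∷ [] = complete-greedy R C chord
  where
  C : Rim R
  C = record
    { x₁ = α ; x₂ = q ; x₃ = α ; x₄ = s ; x₁∈ = α∈R₁₂ ; x₂∈ = q∈ ; x₃∈ = α∈R₃₄ ; x₄∈ = s∈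
    ; x₁≢x₂ = ≢-sym q≢α ; x₂≢x₃ = q≢α ; x₃≢x₄ = ≢-sym s≢α ; x₄≢x₁ = s≢α }
  chord : ∀ b d → ChordColour R C b d
  chord b d with fresh (R₂₄ R) (α ∷ q ∷ s ∷ b ∷ d ∷ []) (6≤R₂₄ R)
  ... | y , y∈ , y≢α ∷ y≢q ∷ y≢s ∷ y≢b ∷ y≢d ∷ [] =
    y , y∈ , y≢α ∷ y≢q ∷ y≢α ∷ y≢s ∷ y≢b ∷ y≢d ∷ []

colour-if-R₂∩R₃₄ : (R : Residual) → Disjoint (R₁₂ R) (R₃₄ R) → Disjoint (R₂₃ R) (R₁₄ R) →
  {β : ℕ} → β ∈ R₂ R → β ∈ R₃₄ R → ResidualColouring R
colour-if-R₂∩R₃₄ R R₁₂#R₃₄ R₂₃#R₁₄ β∈R₂ β∈R₃₄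
  with cycle-through (2≤R₁₄ R) (2≤R₁₂ R) (2≤R₂₃ R) β∈R₃₄ (Disjoint-sym R₂₃#R₁₄)
... | C′ , refl = complete R C β∈R₂ β≢x₁ (≢-sym (x₄≢x₁ C′)) chord
  where
  C : Rim R
  C = rotate-cycle (rotate-cycle C′)
  β≢x₁ : x₁ C′ ≢ x₁ C
  β≢x₁ = ≢-sym (∈-∉⇒≢ (x₁∈ C) λ β∈R₁₂ → R₁₂#R₃₄ (β∈R₁₂ , β∈R₃₄))
  chord : ∀ d → ChordColour R C (x₁ C′) d
  chord d with fresh (R₂₄ R) (x₁ C ∷ x₂ C ∷ x₃ C ∷ x₄ C ∷ d ∷ []) (6≤R₂₄ R)
  ... | y , y∈ , y≢x₁ ∷ y≢x₂ ∷ y≢x₃ ∷ y≢x₄ ∷ y≢d ∷ [] =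
    y , y∈ , y≢x₁ ∷ y≢x₂ ∷ y≢x₃ ∷ y≢x₄ ∷ y≢x₃ ∷ y≢d ∷ []

colour-if-R₁₂⊈R₂₄ : (R : Residual) → Disjoint (R₂₃ R) (R₁₄ R) →
  {α : ℕ} → α ∈ R₁₂ R → α ∉ R₂₄ R → ResidualColouring R
colour-if-R₁₂⊈R₂₄ R R₂₃#R₁₄ α∈R₁₂ α∉R₂₄
  with cycle-through (2≤R₂₃ R) (2≤R₃₄ R) (2≤R₁₄ R) α∈R₁₂ R₂₃#R₁₄
... | C , refl = complete-greedy R C chord
  where
  chord : ∀ b d → ChordColour R C b d
  chord b d with fresh (R₂₄ R) (x₂ C ∷ x₃ C ∷ x₄ C ∷ b ∷ d ∷ []) (6≤R₂₄ R)
  ... | y , y∈ , y≢rest = y , y∈ , ∈-∉⇒≢ y∈ α∉R₂₄ ∷ y≢rest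

colour-if-R₂⊈R₂₄ : (R : Residual) (C : Rim R) {α : ℕ} → α ∈ R₂ R → α ∉ R₂₄ R → ResidualColouring R
colour-if-R₂⊈R₂₄ R C {α} α∈R₂ α∉R₂₄ with α ≟ℕ x₁ C | α ≟ℕ x₂ C
... | yes refl | _ = complete-greedy R C chord
  where
  chord : ∀ b d → ChordColour R C b d
  chord b d with fresh (R₂₄ R) (x₂ C ∷ x₃ C ∷ x₄ C ∷ b ∷ d ∷ []) (6≤R₂₄ R)
  ... | y , y∈ , y≢rest = y , y∈ , ∈-∉⇒≢ y∈ α∉R₂₄ ∷ y≢rest
... | no _ | yes refl = complete-greedy R C chord
  where
  chord : ∀ b d → ChordColour R C b d
  chord b d with fresh (R₂₄ R) (x₁ C ∷ x₃ C ∷ x₄ C ∷ b ∷ d ∷ []) (6≤R₂₄ R)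
  ... | y , y∈ , y≢x₁ ∷ y≢rest = y , y∈ , y≢x₁ ∷ ∈-∉⇒≢ y∈ α∉R₂₄ ∷ y≢rest
... | no α≢x₁ | no α≢x₂ = complete R C α∈R₂ α≢x₁ α≢x₂ chord
  where
  chord : ∀ d → ChordColour R C α d
  chord d with fresh (R₂₄ R) (x₁ C ∷ x₂ C ∷ x₃ C ∷ x₄ C ∷ d ∷ []) (6≤R₂₄ R)
  ... | y , y∈ , y≢x₁ ∷ y≢x₂ ∷ y≢x₃ ∷ y≢x₄ ∷ y≢d ∷ [] =
    y , y∈ , y≢x₁ ∷ y≢x₂ ∷ y≢x₃ ∷ y≢x₄ ∷ ∈-∉⇒≢ y∈ α∉R₂₄ ∷ y≢d ∷ []

record Stuck (R : Residual) : Set where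
  field
    R₂₄≤6   : card (R₂₄ R) ≤ 6
    R₁₂#R₃₄ : Disjoint (R₁₂ R) (R₃₄ R)
    R₂₃#R₁₄ : Disjoint (R₂₃ R) (R₁₄ R)
    R₂#R₃₄  : Disjoint (R₂ R) (R₃₄ R)
    R₂#R₁₄  : Disjoint (R₂ R) (R₁₄ R)
    R₄#R₁₂  : Disjoint (R₄ R) (R₁₂ R)
    R₄#R₂₃  : Disjoint (R₄ R) (R₂₃ R)
    R₂⊆R₂₄  : R₂ R ⊆ R₂₄ R
    R₄⊆R₂₄  : R₄ R ⊆ R₂₄ R
    R₁₂⊆R₂₄ : R₁₂ R ⊆ R₂₄ R
    R₂₃⊆R₂₄ : R₂₃ R ⊆ R₂₄ R
    R₃₄⊆R₂₄ : R₃₄ R ⊆ R₂₄ R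
    R₁₄⊆R₂₄ : R₁₄ R ⊆ R₂₄ R

-- Each failure of a Stuck condition is one of the cases above, up to the symmetries
-- swapping u₁ with u₃ and u₂ with u₄.
colour-or-stuck : (R : Residual) → ResidualColouring R ⊎ Stuck R
colour-or-stuck R with 7 ≤? card (R₂₄ R)
... | yes 7≤R₂₄ = inj₁ (colour-if-R₂₄-large R 7≤R₂₄)
... | no 7≰R₂₄ with common-or-disjoint (R₁₂ R) (R₃₄ R)
... | inj₁ (_ , p , q) = inj₁ (colour-if-R₁₂∩R₃₄ R p q)
... | inj₂ R₁₂#R₃₄ with common-or-disjoint (R₂₃ R) (R₁₄ R)
... | inj₁ (_ , p , q) = inj₁ (unswap₁₃ (colour-if-R₁₂∩R₃₄ (swap₁₃ R) p q))
... | inj₂ R₂₃#R₁₄ with common-or-disjoint (R₂ R) (R₃₄ R)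
... | inj₁ (_ , p , q) = inj₁ (colour-if-R₂∩R₃₄ R R₁₂#R₃₄ R₂₃#R₁₄ p q)
... | inj₂ R₂#R₃₄ with common-or-disjoint (R₂ R) (R₁₄ R)
... | inj₁ (_ , p , q) = inj₁ (unswap₁₃ (colour-if-R₂∩R₃₄ (swap₁₃ R) R₂₃#R₁₄ R₁₂#R₃₄ p q))
... | inj₂ R₂#R₁₄ with common-or-disjoint (R₄ R) (R₂₃ R)
... | inj₁ (_ , p , q) = inj₁ (unswap₂₄
  (colour-if-R₂∩R₃₄ (swap₂₄ R) (Disjoint-sym R₂₃#R₁₄) (Disjoint-sym R₁₂#R₃₄) p q))
... | inj₂ R₄#R₂₃ with common-or-disjoint (R₄ R) (R₁₂ R)
... | inj₁ (_ , p , q) = inj₁ (unswap₂₄ (unswap₁₃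
  (colour-if-R₂∩R₃₄ (swap₁₃ (swap₂₄ R)) (Disjoint-sym R₁₂#R₃₄) (Disjoint-sym R₂₃#R₁₄) p q)))
... | inj₂ R₄#R₁₂ with outside-or-⊆ (R₁₂ R) (R₂₄ R)
... | inj₁ (_ , p , q) = inj₁ (colour-if-R₁₂⊈R₂₄ R R₂₃#R₁₄ p q)
... | inj₂ R₁₂⊆R₂₄ with outside-or-⊆ (R₂₃ R) (R₂₄ R)
... | inj₁ (_ , p , q) = inj₁ (unswap₁₃ (colour-if-R₁₂⊈R₂₄ (swap₁₃ R) R₁₂#R₃₄ p q))
... | inj₂ R₂₃⊆R₂₄ with outside-or-⊆ (R₁₄ R) (R₂₄ R)
... | inj₁ (_ , p , q) = inj₁ (unswap₂₄ (colour-if-R₁₂⊈R₂₄ (swap₂₄ R) (Disjoint-sym R₁₂#R₃₄) p q))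
... | inj₂ R₁₄⊆R₂₄ with outside-or-⊆ (R₃₄ R) (R₂₄ R)
... | inj₁ (_ , p , q) = inj₁ (unswap₂₄ (unswap₁₃
  (colour-if-R₁₂⊈R₂₄ (swap₁₃ (swap₂₄ R)) (Disjoint-sym R₂₃#R₁₄) p q)))
... | inj₂ R₃₄⊆R₂₄ with outside-or-⊆ (R₂ R) (R₂₄ R)
... | inj₁ (_ , p , q) = inj₁ (colour-if-R₂⊈R₂₄ R (some-rim R) p q)
... | inj₂ R₂⊆R₂₄ with outside-or-⊆ (R₄ R) (R₂₄ R)
... | inj₁ (_ , p , q) = inj₁ (unswap₂₄ (colour-if-R₂⊈R₂₄ (swap₂₄ R) (some-rim (swap₂₄ R)) p q))
... | inj₂ R₄⊆R₂₄ = inj₂ record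
  { R₂₄≤6 = ≤-pred (≰⇒> 7≰R₂₄)
  ; R₁₂#R₃₄ = R₁₂#R₃₄ ; R₂₃#R₁₄ = R₂₃#R₁₄ ; R₂#R₃₄ = R₂#R₃₄ ; R₂#R₁₄ = R₂#R₁₄
  ; R₄#R₁₂ = R₄#R₁₂ ; R₄#R₂₃ = R₄#R₂₃
  ; R₂⊆R₂₄ = R₂⊆R₂₄ ; R₄⊆R₂₄ = R₄⊆R₂₄ ; R₁₂⊆R₂₄ = R₁₂⊆R₂₄
  ; R₂₃⊆R₂₄ = R₂₃⊆R₂₄ ; R₃₄⊆R₂₄ = R₃₄⊆R₂₄ ; R₁₄⊆R₂₄ = R₁₄⊆R₂₄ }

-- List total colourings of K₄

-- Lists on the vertices u₁ … u₄ and edges uᵢuⱼ of a K₄ whose 4-cycle is u₁u₂u₃u₄.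
record K4Lists : Set where
  field
    A₁ A₂ A₃ A₄ A₁₂ A₂₃ A₃₄ A₁₄ A₁₃ A₂₄ : List ℕ

record K4Bounds (A : K4Lists) : Set where
  open K4Lists A
  field
    2≤A₁  : 2 ≤ card A₁
    6≤A₂  : 6 ≤ card A₂
    2≤A₃  : 2 ≤ card A₃
    6≤A₄  : 6 ≤ card A₄
    4≤A₁₂ : 4 ≤ card A₁₂
    4≤A₂₃ : 4 ≤ card A₂₃
    4≤A₃₄ : 4 ≤ card A₃₄
    4≤A₁₄ : 4 ≤ card A₁₄
    2≤A₁₃ : 2 ≤ card A₁₃
    6≤A₂₄ : 6 ≤ card A₂₄
    not-all-same : card A₁ ≡ 2 → card A₃ ≡ 2 → card A₁₃ ≡ 2 → ¬ ((A₁ ≈ₛ A₃) × (A₃ ≈ₛ A₁₃))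

record K4Colouring (A : K4Lists) : Set where
  open K4Lists A
  field
    c₁ c₂ c₃ c₄ c₁₂ c₂₃ c₃₄ c₁₄ c₁₃ c₂₄ : ℕ
    c₁∈ : c₁ ∈ A₁
    c₂∈ : c₂ ∈ A₂
    c₃∈ : c₃ ∈ A₃
    c₄∈ : c₄ ∈ A₄
    c₁₂∈ : c₁₂ ∈ A₁₂
    c₂₃∈ : c₂₃ ∈ A₂₃
    c₃₄∈ : c₃₄ ∈ A₃₄
    c₁₄∈ : c₁₄ ∈ A₁₄
    c₁₃∈ : c₁₃ ∈ A₁₃
    c₂₄∈ : c₂₄ ∈ A₂₄
    c₁≢c₂ : c₁ ≢ c₂
    c₁≢c₃ : c₁ ≢ c₃
    c₁≢c₄ : c₁ ≢ c₄
    c₂≢c₃ : c₂ ≢ c₃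
    c₂≢c₄ : c₂ ≢ c₄
    c₃≢c₄ : c₃ ≢ c₄
    c₁≢c₁₂ : c₁ ≢ c₁₂
    c₁≢c₁₃ : c₁ ≢ c₁₃
    c₁≢c₁₄ : c₁ ≢ c₁₄
    c₂≢c₁₂ : c₂ ≢ c₁₂
    c₂≢c₂₃ : c₂ ≢ c₂₃
    c₂≢c₂₄ : c₂ ≢ c₂₄
    c₃≢c₁₃ : c₃ ≢ c₁₃
    c₃≢c₂₃ : c₃ ≢ c₂₃
    c₃≢c₃₄ : c₃ ≢ c₃₄
    c₄≢c₁₄ : c₄ ≢ c₁₄
    c₄≢c₂₄ : c₄ ≢ c₂₄
    c₄≢c₃₄ : c₄ ≢ c₃₄
    c₁₂≢c₁₃ : c₁₂ ≢ c₁₃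
    c₁₂≢c₁₄ : c₁₂ ≢ c₁₄
    c₁₃≢c₁₄ : c₁₃ ≢ c₁₄
    c₁₂≢c₂₃ : c₁₂ ≢ c₂₃
    c₁₂≢c₂₄ : c₁₂ ≢ c₂₄
    c₂₃≢c₂₄ : c₂₃ ≢ c₂₄
    c₁₃≢c₂₃ : c₁₃ ≢ c₂₃
    c₁₃≢c₃₄ : c₁₃ ≢ c₃₄
    c₂₃≢c₃₄ : c₂₃ ≢ c₃₄
    c₁₄≢c₂₄ : c₁₄ ≢ c₂₄
    c₁₄≢c₃₄ : c₁₄ ≢ c₃₄
    c₂₄≢c₃₄ : c₂₄ ≢ c₃₄

module _ (A : K4Lists) (bounds : K4Bounds A) where
  open K4Lists A
  open K4Bounds bounds

  Triangle : Set
  Triangle = Transversal A₁ A₃ A₁₃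

  residual : Triangle → Residual
  residual T = record
    { R₂ = A₂ ∖ (p T ∷ q T ∷ []) ; R₄ = A₄ ∖ (p T ∷ q T ∷ []) ; R₂₄ = A₂₄
    ; R₁₂ = A₁₂ ∖ (p T ∷ r T ∷ []) ; R₂₃ = A₂₃ ∖ (q T ∷ r T ∷ [])
    ; R₃₄ = A₃₄ ∖ (q T ∷ r T ∷ []) ; R₁₄ = A₁₄ ∖ (p T ∷ r T ∷ [])
    ; 4≤R₂ = card-∖-pair A₂ 6≤A₂ ; 4≤R₄ = card-∖-pair A₄ 6≤A₄ ; 6≤R₂₄ = 6≤A₂₄
    ; 2≤R₁₂ = card-∖-pair A₁₂ 4≤A₁₂ ; 2≤R₂₃ = card-∖-pair A₂₃ 4≤A₂₃
    ; 2≤R₃₄ = card-∖-pair A₃₄ 4≤A₃₄ ; 2≤R₁₄ = card-∖-pair A₁₄ 4≤A₁₄ }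

  lift : (T : Triangle) → ResidualColouring (residual T) → K4Colouring A
  lift T S =
    let c₂∈A₂ , c₂≢p , c₂≢q = ∈-∖-pair⁻ A₂ c₂∈
        c₄∈A₄ , c₄≢p , c₄≢q = ∈-∖-pair⁻ A₄ c₄∈
        c₁₂∈A₁₂ , c₁₂≢p , c₁₂≢r = ∈-∖-pair⁻ A₁₂ c₁₂∈
        c₂₃∈A₂₃ , c₂₃≢q , c₂₃≢r = ∈-∖-pair⁻ A₂₃ c₂₃∈
        c₃₄∈A₃₄ , c₃₄≢q , c₃₄≢r = ∈-∖-pair⁻ A₃₄ c₃₄∈
        c₁₄∈A₁₄ , c₁₄≢p , c₁₄≢r = ∈-∖-pair⁻ A₁₄ c₁₄∈
    in record
    { c₁ = p T ; c₂ = c₂ ; c₃ = q T ; c₄ = c₄ ; c₁₂ = c₁₂ ; c₂₃ = c₂₃ ; c₃₄ = c₃₄ ; c₁₄ = c₁₄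
    ; c₁₃ = r T ; c₂₄ = c₂₄
    ; c₁∈ = p∈ T ; c₂∈ = c₂∈A₂ ; c₃∈ = q∈ T ; c₄∈ = c₄∈A₄ ; c₁₂∈ = c₁₂∈A₁₂ ; c₂₃∈ = c₂₃∈A₂₃
    ; c₃₄∈ = c₃₄∈A₃₄ ; c₁₄∈ = c₁₄∈A₁₄ ; c₁₃∈ = r∈ T ; c₂₄∈ = c₂₄∈
    ; c₁≢c₂ = ≢-sym c₂≢p ; c₁≢c₃ = p≢q T ; c₁≢c₄ = ≢-sym c₄≢p
    ; c₂≢c₃ = c₂≢q ; c₂≢c₄ = c₂≢c₄ ; c₃≢c₄ = ≢-sym c₄≢q
    ; c₁≢c₁₂ = ≢-sym c₁₂≢p ; c₁≢c₁₃ = p≢r T ; c₁≢c₁₄ = ≢-sym c₁₄≢p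
    ; c₂≢c₁₂ = c₂≢c₁₂ ; c₂≢c₂₃ = c₂≢c₂₃ ; c₂≢c₂₄ = c₂≢c₂₄
    ; c₃≢c₁₃ = q≢r T ; c₃≢c₂₃ = ≢-sym c₂₃≢q ; c₃≢c₃₄ = ≢-sym c₃₄≢q
    ; c₄≢c₁₄ = c₄≢c₁₄ ; c₄≢c₂₄ = c₄≢c₂₄ ; c₄≢c₃₄ = c₄≢c₃₄
    ; c₁₂≢c₁₃ = c₁₂≢r ; c₁₂≢c₁₄ = ≢-sym c₁₄≢c₁₂ ; c₁₃≢c₁₄ = ≢-sym c₁₄≢r
    ; c₁₂≢c₂₃ = c₁₂≢c₂₃ ; c₁₂≢c₂₄ = ≢-sym c₂₄≢c₁₂ ; c₂₃≢c₂₄ = ≢-sym c₂₄≢c₂₃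
    ; c₁₃≢c₂₃ = ≢-sym c₂₃≢r ; c₁₃≢c₃₄ = ≢-sym c₃₄≢r ; c₂₃≢c₃₄ = c₂₃≢c₃₄
    ; c₁₄≢c₂₄ = ≢-sym c₂₄≢c₁₄ ; c₁₄≢c₃₄ = ≢-sym c₃₄≢c₁₄ ; c₂₄≢c₃₄ = c₂₄≢c₃₄ }
    where open ResidualColouring S

  stuck⇒removed-present : (T : Triangle) → Stuck (residual T) →
    (p T ∈ A₁₂ × r T ∈ A₁₂) × (q T ∈ A₂₃ × r T ∈ A₂₃) × (q T ∈ A₃₄ × r T ∈ A₃₄) × (p T ∈ A₁₄ × r T ∈ A₁₄)
  stuck⇒removed-present T stuck =
      removed-present A₁₂ 4≤A₁₂ (beside (4≤R₄ (residual T)) R₄#R₁₂ R₄⊆R₂₄ R₁₂⊆R₂₄)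
    , removed-present A₂₃ 4≤A₂₃ (beside (4≤R₄ (residual T)) R₄#R₂₃ R₄⊆R₂₄ R₂₃⊆R₂₄)
    , removed-present A₃₄ 4≤A₃₄ (beside (4≤R₂ (residual T)) R₂#R₃₄ R₂⊆R₂₄ R₃₄⊆R₂₄)
    , removed-present A₁₄ 4≤A₁₄ (beside (4≤R₂ (residual T)) R₂#R₁₄ R₂⊆R₂₄ R₁₄⊆R₂₄)
    where
    open Stuck stuck
    beside : ∀ {M N} → 4 ≤ card M → Disjoint M N → M ⊆ A₂₄ → N ⊆ A₂₄ → card N ≤ 2
    beside 4≤M M#N M⊆ N⊆ = disjoint-beside-4-in-6⇒≤2 4≤M M#N M⊆ N⊆ R₂₄≤6

  -- A colour of T′ that differs from T's survives in residual lists of T which the Stuck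
  -- conditions make disjoint from a large one, overfilling the six chord colours.
  stuck-unique : (T T′ : Triangle) → Stuck (residual T) → Stuck (residual T′) → triple T ≡ triple T′
  stuck-unique T T′ stuck stuck′ with stuck⇒removed-present T′ stuck′
  ... | (p′∈A₁₂ , r′∈A₁₂) , (q′∈A₂₃ , _) , (q′∈A₃₄ , r′∈A₃₄) , (p′∈A₁₄ , _) =
    cong₂ _,_ p≡p′ (cong₂ _,_ q≡q′ r≡r′)
    where
    open Stuck stuck
    R : Residual
    R = residual T
    no-room : ∀ {M N z} → 4 ≤ card M → 2 ≤ card N → Disjoint M N → M ⊆ A₂₄ → N ⊆ A₂₄ →
      z ∉ M → z ∉ N → z ∈ A₂₄ → ⊥
    no-room 4≤M 2≤N M#N M⊆ N⊆ z∉M z∉N z∈ =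
      contradiction R₂₄≤6 (disjoint-4+2+1-in-6⇒⊥ 4≤M 2≤N M#N z∉M z∉N M⊆ N⊆ z∈)

    r≡r′ : r T ≡ r T′
    r≡r′ with r T′ ≟ℕ r T | r T′ ≟ℕ p T | r T′ ≟ℕ q T
    ... | yes r′≡r | _ | _ = sym r′≡r
    ... | no _ | yes r′≡p | _ =
      ⊥-elim $ no-room (4≤R₂ R) (2≤R₁₄ R) R₂#R₁₄ R₂⊆R₂₄ R₁₄⊆R₂₄ (∉-∖-pairˡ A₂) (∉-∖-pairˡ A₁₄)
        (R₃₄⊆R₂₄ (∈-∖-pair⁺ (subst (_∈ A₃₄) r′≡p r′∈A₃₄) (p≢q T) (p≢r T)))
    ... | no _ | no _ | yes r′≡q =
      ⊥-elim $ no-room (4≤R₄ R) (2≤R₂₃ R) R₄#R₂₃ R₄⊆R₂₄ R₂₃⊆R₂₄ (∉-∖-pairʳ A₄) (∉-∖-pairˡ A₂₃)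
        (R₁₂⊆R₂₄ (∈-∖-pair⁺ (subst (_∈ A₁₂) r′≡q r′∈A₁₂) (≢-sym (p≢q T)) (q≢r T)))
    ... | no r′≢r | no r′≢p | no r′≢q =
      contradiction (∈-∖-pair⁺ r′∈A₁₂ r′≢p r′≢r , ∈-∖-pair⁺ r′∈A₃₄ r′≢q r′≢r) R₁₂#R₃₄

    p≡p′ : p T ≡ p T′
    p≡p′ with p T′ ≟ℕ p T
    ... | yes p′≡p = sym p′≡p
    ... | no p′≢p =
      ⊥-elim $ no-room (4≤R₂ R) (2≤R₃₄ R) R₂#R₃₄ R₂⊆R₂₄ R₃₄⊆R₂₄
        (λ p′∈R₂ → R₂#R₁₄ (p′∈R₂ , p′∈R₁₄)) (λ p′∈R₃₄ → R₁₂#R₃₄ (p′∈R₁₂ , p′∈R₃₄)) (R₁₂⊆R₂₄ p′∈R₁₂)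
      where
      p′≢r : p T′ ≢ r T
      p′≢r p′≡r = p≢r T′ (trans p′≡r r≡r′)
      p′∈R₁₂ : p T′ ∈ R₁₂ R
      p′∈R₁₂ = ∈-∖-pair⁺ p′∈A₁₂ p′≢p p′≢r
      p′∈R₁₄ : p T′ ∈ R₁₄ R
      p′∈R₁₄ = ∈-∖-pair⁺ p′∈A₁₄ p′≢p p′≢r

    q≡q′ : q T ≡ q T′
    q≡q′ with q T′ ≟ℕ q T
    ... | yes q′≡q = sym q′≡q
    ... | no q′≢q =
      ⊥-elim $ no-room (4≤R₄ R) (2≤R₁₂ R) R₄#R₁₂ R₄⊆R₂₄ R₁₂⊆R₂₄
        (λ q′∈R₄ → R₄#R₂₃ (q′∈R₄ , q′∈R₂₃)) (λ q′∈R₁₂ → R₁₂#R₃₄ (q′∈R₁₂ , q′∈R₃₄)) (R₂₃⊆R₂₄ q′∈R₂₃)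
      where
      q′≢r : q T′ ≢ r T
      q′≢r q′≡r = q≢r T′ (trans q′≡r r≡r′)
      q′∈R₂₃ : q T′ ∈ R₂₃ R
      q′∈R₂₃ = ∈-∖-pair⁺ q′∈A₂₃ q′≢q q′≢r
      q′∈R₃₄ : q T′ ∈ R₃₄ R
      q′∈R₃₄ = ∈-∖-pair⁺ q′∈A₃₄ q′≢q q′≢r

  first-triangle : Triangle
  first-triangle = transversal 2≤A₁ 2≤A₃ 2≤A₁₃ not-all-same

  k4-colouring : K4Colouring A
  k4-colouring with colour-or-stuck (residual first-triangle)
  ... | inj₁ S = lift first-triangle S
  ... | inj₂ stuck₁ with another-transversal 2≤A₁ 2≤A₃ 2≤A₁₃ first-triangle
  ... | T₂ , T₂≢T₁ with colour-or-stuck (residual T₂)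
  ... | inj₁ S = lift T₂ S
  ... | inj₂ stuck₂ = contradiction (stuck-unique T₂ first-triangle stuck₂ stuck₁) T₂≢T₁

-- Extending a partial total colouring

∈-maybeList : ∀ {m c} → m ≡ just c → c ∈ maybeList m
∈-maybeList refl = here refl

concatMap-cong-↭ : ∀ {A B : Set} {f g : A → List B} → (∀ x → f x ↭ g x) → ∀ xs → concatMap f xs ↭ concatMap g xs
concatMap-cong-↭ f↭g []       = _↭_.refl
concatMap-cong-↭ f↭g (x ∷ xs) = ++⁺-↭ (f↭g x) (concatMap-cong-↭ f↭g xs)

module _ {G : Graph} (φ : PartialCol G) where

  ∈-usedV : ∀ {v w c} → Edge G v w → (pv φ w ≡ just c ⊎ pe φ v w ≡ just c) → c ∈ usedV G φ v
  ∈-usedV {v} {w} {c} vw coloured = ∈-concatMap⁺ _ (lose (∈-allFin w) at-w)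
    where
    at-w : c ∈ (if adj G v w then maybeList (pv φ w) ++ maybeList (pe φ v w) else [])
    at-w rewrite Equivalence.to T-≡ vw =
      [ (λ p → ∈-++⁺ˡ (∈-maybeList p)) , (λ p → ∈-++⁺ʳ (maybeList (pv φ w)) (∈-maybeList p)) ]′ coloured

  ∈-usedE : ∀ {u v w c} → Edge G u w → w ≢ v → pe φ u w ≡ just c → c ∈ usedE G φ u v
  ∈-usedE {u} {v} {w} {c} uw w≢v coloured =
    ∈-++⁺ʳ (maybeList (pv φ u)) (∈-++⁺ʳ (maybeList (pv φ v)) (∈-concatMap⁺ _ (lose (∈-allFin w) at-w)))
    where
    at-w : c ∈ (if adj G u w ∧ not ⌊ w ≟F v ⌋ then maybeList (pe φ u w) else []) ++
               (if adj G v w ∧ not ⌊ w ≟F u ⌋ then maybeList (pe φ v w) else [])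
    at-w rewrite Equivalence.to T-≡ uw with w ≟F v
    ... | yes w≡v = contradiction w≡v w≢v
    ... | no  _   = ∈-++⁺ˡ (∈-maybeList coloured)

  usedE-comm : ∀ u v → usedE G φ v u ↭ usedE G φ u v
  usedE-comm u v = ↭-trans (shifts (maybeList (pv φ v)) (maybeList (pv φ u)))
    (++⁺ˡ-↭ (maybeList (pv φ u)) (++⁺ˡ-↭ (maybeList (pv φ v))
      (concatMap-cong-↭ (λ w → ++-comm (around v u w) (around u v w)) (allFin (n G)))))
    where
    around : Vtx G → Vtx G → Vtx G → List ℕ
    around x y w = if adj G x w ∧ not ⌊ w ≟F y ⌋ then maybeList (pe φ x w) else []

Edge-sym : ∀ {G} {u v : Vtx G} → Edge G u v → Edge G v u
Edge-sym {G} {u} {v} = subst T (Graph.sym G u v)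

module _ {G : Graph} (L : ListAssignment G) (φ : PartialCol G) where

  LavV-avoids : ∀ {v w c c′} → c ∈ LavV G L φ v → Edge G v w →
    (pv φ w ≡ just c′ ⊎ pe φ v w ≡ just c′) → c ≢ c′
  LavV-avoids {v} c∈ vw coloured refl = proj₂ (∈-∖⁻ (Lv L v) (usedV G φ v) c∈) (∈-usedV φ vw coloured)

  LavE-avoids : ∀ {u v w c c′} → c ∈ LavE G L φ u v → Edge G u w → w ≢ v → pe φ u w ≡ just c′ → c ≢ c′
  LavE-avoids {u} {v} c∈ uw w≢v coloured refl =
    proj₂ (∈-∖⁻ (Le L u v) (usedE G φ u v) c∈) (∈-usedE φ uw w≢v coloured)

  LavE-comm : ∀ {u v} → Edge G u v → LavE G L φ u v ⊆ LavE G L φ v u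
  LavE-comm {u} {v} uv c∈ with ∈-∖⁻ (Le L u v) (usedE G φ u v) c∈
  ... | c∈Le , c∉used = ∈-∖⁺ (usedE G φ v u) (subst (_ ∈_) (Lsym L u v uv) c∈Le)
                              (λ c∈used′ → c∉used (Any-resp-↭ (usedE-comm φ u v) c∈used′))

differ⇒≢ : ∀ {a b x y} → Differ a b → a ≡ just x → b ≡ just y → x ≢ y
differ⇒≢ a#b a≡ b≡ refl = a#b _ a≡ b≡

-- The available lists avoid every colour φ puts next to an element, so only conflicts
-- among the newly coloured corner elements remain to be checked.
module Extension
  {G : Graph} (L : ListAssignment G) (φ : PartialCol G) (φ-proper : IsPartialLTotal G L φ)
  {k : ℕ} (corner : Fin k → Vtx G)
  (uncoloured-vertex : ∀ v → pv φ v ≡ nothing → ∃[ i ] v ≡ corner i)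
  (uncoloured-edge : ∀ u v → Edge G u v → pe φ u v ≡ nothing →
                     (∃[ i ] u ≡ corner i) × (∃[ j ] v ≡ corner j))
  (corner-uncoloured : ∀ i → pv φ (corner i) ≡ nothing)
  (corner-edge-uncoloured : ∀ i j → Edge G (corner i) (corner j) → pe φ (corner i) (corner j) ≡ nothing)
  where

  record CornerColouring : Set where
    field
      κv : Fin k → ℕ
      κe : Fin k → Fin k → ℕ
      κv-available : ∀ i → κv i ∈ LavV G L φ (corner i)
      κe-available : ∀ i j → Edge G (corner i) (corner j) → κe i j ∈ LavE G L φ (corner i) (corner j)
      κe-sym : ∀ i j → Edge G (corner i) (corner j) → κe i j ≡ κe j i
      κv≢κv : ∀ i j → Edge G (corner i) (corner j) → κv i ≢ κv j
      κv≢κe : ∀ i j → Edge G (corner i) (corner j) → κv i ≢ κe i j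
      κe≢κe : ∀ i j l → Edge G (corner i) (corner j) → Edge G (corner i) (corner l) → j ≢ l → κe i j ≢ κe i l

  data Position (v : Vtx G) : Set where
    at  : ∀ i → v ≡ corner i → Position v
    off : (∀ i → v ≢ corner i) → Position v

  position : ∀ v → Position v
  position v with any-Fin? (λ i → v ≟F corner i)
  ... | yes (i , v≡) = at i v≡
  ... | no ∄i = off λ i v≡ → ∄i (i , v≡)

  off-vertex-coloured : ∀ {v} → (∀ i → v ≢ corner i) → pv φ v ≡ just (fromMaybe 0 (pv φ v))
  off-vertex-coloured {v} v-off with pv φ v in eq
  ... | just _  = refl
  ... | nothing = contradiction (proj₂ (uncoloured-vertex v eq)) (v-off (proj₁ (uncoloured-vertex v eq)))

  off-edge-coloured : ∀ {u v} → Edge G u v → (∀ i → u ≢ corner i) ⊎ (∀ i → v ≢ corner i) →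
    pe φ u v ≡ just (fromMaybe 0 (pe φ u v))
  off-edge-coloured {u} {v} uv off-end with pe φ u v in eq
  ... | just _  = refl
  ... | nothing with uncoloured-edge u v uv eq
  ...   | (i , u≡) , (j , v≡) =
    [ (λ u-off → contradiction u≡ (u-off i)) , (λ v-off → contradiction v≡ (v-off j)) ]′ off-end

  module _ (κ : CornerColouring) where
    open CornerColouring κ
    module φ = IsPartialLTotal φ-proper

    -- Off the corners φ is defined, so the default 0 of fromMaybe is never used.
    vertexColour : ∀ {v} → Position v → ℕ
    vertexColour (at i _)    = κv i
    vertexColour {v} (off _) = fromMaybe 0 (pv φ v)

    edgeColour : ∀ {u v} → Position u → Position v → ℕ
    edgeColour (at i _) (at j _) = κe i j
    edgeColour {u} {v} _ _       = fromMaybe 0 (pe φ u v)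

    cv : Vtx G → ℕ
    cv v = vertexColour (position v)

    ce : Vtx G → Vtx G → ℕ
    ce u v = edgeColour (position u) (position v)

    ce-sym : ∀ u v → Edge G u v → ce u v ≡ ce v u
    ce-sym u v uv with position u | position v
    ... | at i refl | at j refl = κe-sym i j uv
    ... | at _ _    | off _     = cong (fromMaybe 0) (φ.esym u v uv)
    ... | off _     | at _ _    = cong (fromMaybe 0) (φ.esym u v uv)
    ... | off _     | off _     = cong (fromMaybe 0) (φ.esym u v uv)

    cv∈ : ∀ v → cv v ∈ Lv L v
    cv∈ v with position v
    ... | at i refl = proj₁ (∈-∖⁻ (Lv L (corner i)) _ (κv-available i))
    ... | off v-off = φ.vlist v _ (off-vertex-coloured v-off)

    ce∈ : ∀ u v → Edge G u v → ce u v ∈ Le L u v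
    ce∈ u v uv with position u | position v
    ... | at i refl | at j refl = proj₁ (∈-∖⁻ (Le L (corner i) (corner j)) _ (κe-available i j uv))
    ... | at _ _    | off v-off = φ.elist u v uv _ (off-edge-coloured uv (inj₂ v-off))
    ... | off u-off | _         = φ.elist u v uv _ (off-edge-coloured uv (inj₁ u-off))

    cv≢cv : ∀ u v → Edge G u v → cv u ≢ cv v
    cv≢cv u v uv with position u | position v
    ... | at i refl | at j refl = κv≢κv i j uv
    ... | at i refl | off v-off = LavV-avoids L φ (κv-available i) uv (inj₁ (off-vertex-coloured v-off))
    ... | off u-off | at j refl =
      ≢-sym (LavV-avoids L φ (κv-available j) (Edge-sym {G} uv) (inj₁ (off-vertex-coloured u-off)))
    ... | off u-off | off v-off = differ⇒≢ (φ.vv u v uv) (off-vertex-coloured u-off) (off-vertex-coloured v-off)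

    ce≢ce : ∀ u v w → Edge G u v → Edge G u w → v ≢ w → ce u v ≢ ce u w
    ce≢ce u v w uv uw v≢w with position u | position v | position w
    ... | at i refl | at j refl | at l refl = κe≢κe i j l uv uw λ { refl → v≢w refl }
    ... | at i refl | at j refl | off w-off =
      LavE-avoids L φ (κe-available i j uv) uw (w-off j) (off-edge-coloured uw (inj₂ w-off))
    ... | at i refl | off v-off | at l refl =
      ≢-sym (LavE-avoids L φ (κe-available i l uw) uv (v-off l) (off-edge-coloured uv (inj₂ v-off)))
    ... | at _ _    | off v-off | off w-off =
      differ⇒≢ (φ.ee u v w uv uw v≢w) (off-edge-coloured uv (inj₂ v-off)) (off-edge-coloured uw (inj₂ w-off))
    ... | off u-off | _ | _ =
      differ⇒≢ (φ.ee u v w uv uw v≢w) (off-edge-coloured uv (inj₁ u-off)) (off-edge-coloured uw (inj₁ u-off))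

    cv≢ce : ∀ u v → Edge G u v → cv u ≢ ce u v
    cv≢ce u v uv with position u | position v
    ... | at i refl | at j refl = κv≢κe i j uv
    ... | at i refl | off v-off =
      LavV-avoids L φ (κv-available i) uv (inj₂ (off-edge-coloured uv (inj₂ v-off)))
    ... | off u-off | _ = differ⇒≢ (φ.ve u v uv) (off-vertex-coloured u-off) (off-edge-coloured uv (inj₁ u-off))

    cv-extends : ∀ v c → pv φ v ≡ just c → cv v ≡ c
    cv-extends v c coloured with position v
    ... | at i refl = contradiction (trans (sym (corner-uncoloured i)) coloured) λ ()
    ... | off _     = cong (fromMaybe 0) coloured

    ce-extends : ∀ u v c → Edge G u v → pe φ u v ≡ just c → ce u v ≡ c
    ce-extends u v c uv coloured with position u | position v
    ... | at i refl | at j refl = contradiction (trans (sym (corner-edge-uncoloured i j uv)) coloured) λ ()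
    ... | at _ _    | off _     = cong (fromMaybe 0) coloured
    ... | off _     | _         = cong (fromMaybe 0) coloured

    extension : ∃[ cv ] ∃[ ce ] IsLTotal G L cv ce × Extends G φ cv ce
    extension = cv , ce
      , record { esym = ce-sym ; vlist = cv∈ ; elist = ce∈ ; vv = cv≢cv ; ee = ce≢ce ; ve = cv≢ce }
      , cv-extends , ce-extends

module K4Corners {G : Graph} (L : ListAssignment G) (φ : PartialCol G) (u₁ u₂ u₃ u₄ : Vtx G) where

  corner : Fin 4 → Vtx G
  corner 0F = u₁
  corner 1F = u₂
  corner 2F = u₃
  corner 3F = u₄

  available : K4Lists
  available = record
    { A₁ = LavV G L φ u₁ ; A₂ = LavV G L φ u₂ ; A₃ = LavV G L φ u₃ ; A₄ = LavV G L φ u₄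
    ; A₁₂ = LavE G L φ u₁ u₂ ; A₂₃ = LavE G L φ u₂ u₃ ; A₃₄ = LavE G L φ u₃ u₄
    ; A₁₄ = LavE G L φ u₁ u₄ ; A₁₃ = LavE G L φ u₁ u₃ ; A₂₄ = LavE G L φ u₂ u₄ }

  UncolouredVertices : Set
  UncolouredVertices = ∀ v → (pv φ v ≡ nothing) ⇔ (v ≡ u₁ ⊎ v ≡ u₂ ⊎ v ≡ u₃ ⊎ v ≡ u₄)

  UncolouredEdges : Set
  UncolouredEdges = ∀ u v → Edge G u v →
    (pe φ u v ≡ nothing) ⇔
      (SamePair u₁ u₂ u v ⊎ SamePair u₂ u₃ u v ⊎ SamePair u₃ u₄ u v ⊎
       SamePair u₁ u₄ u v ⊎ SamePair u₂ u₄ u v ⊎ SamePair u₁ u₃ u v)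

  no-loop : ∀ {v} → ¬ Edge G v v
  no-loop {v} = subst T (irrefl G v)

  module _ (uncoloured-vertices : UncolouredVertices) where

    uncoloured-vertex : ∀ v → pv φ v ≡ nothing → ∃[ i ] v ≡ corner i
    uncoloured-vertex v v-uncoloured with Equivalence.to (uncoloured-vertices v) v-uncoloured
    ... | inj₁ v≡                   = 0F , v≡
    ... | inj₂ (inj₁ v≡)            = 1F , v≡
    ... | inj₂ (inj₂ (inj₁ v≡))     = 2F , v≡
    ... | inj₂ (inj₂ (inj₂ v≡))     = 3F , v≡

    corner-uncoloured : ∀ i → pv φ (corner i) ≡ nothing
    corner-uncoloured 0F = Equivalence.from (uncoloured-vertices u₁) (inj₁ refl)
    corner-uncoloured 1F = Equivalence.from (uncoloured-vertices u₂) (inj₂ (inj₁ refl))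
    corner-uncoloured 2F = Equivalence.from (uncoloured-vertices u₃) (inj₂ (inj₂ (inj₁ refl)))
    corner-uncoloured 3F = Equivalence.from (uncoloured-vertices u₄) (inj₂ (inj₂ (inj₂ refl)))

  module _ (uncoloured-edges : UncolouredEdges) where

    pair-corners : ∀ {u v} i j → SamePair (corner i) (corner j) u v →
      (∃[ a ] u ≡ corner a) × (∃[ b ] v ≡ corner b)
    pair-corners i j (inj₁ (u≡ , v≡)) = (i , u≡) , (j , v≡)
    pair-corners i j (inj₂ (u≡ , v≡)) = (j , u≡) , (i , v≡)

    uncoloured-edge : ∀ u v → Edge G u v → pe φ u v ≡ nothing →
      (∃[ i ] u ≡ corner i) × (∃[ j ] v ≡ corner j)
    uncoloured-edge u v uv uv-uncoloured with Equivalence.to (uncoloured-edges u v uv) uv-uncoloured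
    ... | inj₁ p                               = pair-corners 0F 1F p
    ... | inj₂ (inj₁ p)                        = pair-corners 1F 2F p
    ... | inj₂ (inj₂ (inj₁ p))                 = pair-corners 2F 3F p
    ... | inj₂ (inj₂ (inj₂ (inj₁ p)))          = pair-corners 0F 3F p
    ... | inj₂ (inj₂ (inj₂ (inj₂ (inj₁ p))))   = pair-corners 1F 3F p
    ... | inj₂ (inj₂ (inj₂ (inj₂ (inj₂ p))))   = pair-corners 0F 2F p

    corner-edge-uncoloured : ∀ i j → Edge G (corner i) (corner j) → pe φ (corner i) (corner j) ≡ nothing
    corner-edge-uncoloured i j e = Equivalence.from (uncoloured-edges (corner i) (corner j) e) (listed i j e)
      where
      listed : ∀ i j → Edge G (corner i) (corner j) →
        SamePair u₁ u₂ (corner i) (corner j) ⊎ SamePair u₂ u₃ (corner i) (corner j) ⊎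
        SamePair u₃ u₄ (corner i) (corner j) ⊎ SamePair u₁ u₄ (corner i) (corner j) ⊎
        SamePair u₂ u₄ (corner i) (corner j) ⊎ SamePair u₁ u₃ (corner i) (corner j)
      listed 0F 1F _ = inj₁ (inj₁ (refl , refl))
      listed 1F 0F _ = inj₁ (inj₂ (refl , refl))
      listed 1F 2F _ = inj₂ (inj₁ (inj₁ (refl , refl)))
      listed 2F 1F _ = inj₂ (inj₁ (inj₂ (refl , refl)))
      listed 2F 3F _ = inj₂ (inj₂ (inj₁ (inj₁ (refl , refl))))
      listed 3F 2F _ = inj₂ (inj₂ (inj₁ (inj₂ (refl , refl))))
      listed 0F 3F _ = inj₂ (inj₂ (inj₂ (inj₁ (inj₁ (refl , refl)))))
      listed 3F 0F _ = inj₂ (inj₂ (inj₂ (inj₁ (inj₂ (refl , refl)))))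
      listed 1F 3F _ = inj₂ (inj₂ (inj₂ (inj₂ (inj₁ (inj₁ (refl , refl))))))
      listed 3F 1F _ = inj₂ (inj₂ (inj₂ (inj₂ (inj₁ (inj₂ (refl , refl))))))
      listed 0F 2F _ = inj₂ (inj₂ (inj₂ (inj₂ (inj₂ (inj₁ (refl , refl))))))
      listed 2F 0F _ = inj₂ (inj₂ (inj₂ (inj₂ (inj₂ (inj₂ (refl , refl))))))
      listed 0F 0F e = ⊥-elim (no-loop e)
      listed 1F 1F e = ⊥-elim (no-loop e)
      listed 2F 2F e = ⊥-elim (no-loop e)
      listed 3F 3F e = ⊥-elim (no-loop e)

  module Completion (φ-proper : IsPartialLTotal G L φ)
                    (uncoloured-vertices : UncolouredVertices) (uncoloured-edges : UncolouredEdges) where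
    open Extension L φ φ-proper corner (uncoloured-vertex uncoloured-vertices) (uncoloured-edge uncoloured-edges)
                   (corner-uncoloured uncoloured-vertices) (corner-edge-uncoloured uncoloured-edges)
      public

    corner-colouring : K4Colouring available → CornerColouring
    corner-colouring K = record
      { κv = κv ; κe = κe ; κv-available = κv-available ; κe-available = κe-available ; κe-sym = κe-sym
      ; κv≢κv = κv≢κv ; κv≢κe = κv≢κe ; κe≢κe = κe≢κe }
      where
      open K4Colouring K

      κv : Fin 4 → ℕ
      κv 0F = c₁
      κv 1F = c₂
      κv 2F = c₃
      κv 3F = c₄

      κe : Fin 4 → Fin 4 → ℕ
      κe 0F 1F = c₁₂
      κe 1F 0F = c₁₂
      κe 1F 2F = c₂₃
      κe 2F 1F = c₂₃
      κe 2F 3F = c₃₄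
      κe 3F 2F = c₃₄
      κe 0F 3F = c₁₄
      κe 3F 0F = c₁₄
      κe 0F 2F = c₁₃
      κe 2F 0F = c₁₃
      κe 1F 3F = c₂₄
      κe 3F 1F = c₂₄
      κe _  _  = 0

      κv-available : ∀ i → κv i ∈ LavV G L φ (corner i)
      κv-available 0F = c₁∈
      κv-available 1F = c₂∈
      κv-available 2F = c₃∈
      κv-available 3F = c₄∈

      κe-available : ∀ i j → Edge G (corner i) (corner j) → κe i j ∈ LavE G L φ (corner i) (corner j)
      κe-available 0F 1F _ = c₁₂∈
      κe-available 1F 2F _ = c₂₃∈
      κe-available 2F 3F _ = c₃₄∈
      κe-available 0F 3F _ = c₁₄∈
      κe-available 0F 2F _ = c₁₃∈
      κe-available 1F 3F _ = c₂₄∈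
      κe-available 1F 0F e = LavE-comm L φ (Edge-sym {G} e) c₁₂∈
      κe-available 2F 1F e = LavE-comm L φ (Edge-sym {G} e) c₂₃∈
      κe-available 3F 2F e = LavE-comm L φ (Edge-sym {G} e) c₃₄∈
      κe-available 3F 0F e = LavE-comm L φ (Edge-sym {G} e) c₁₄∈
      κe-available 2F 0F e = LavE-comm L φ (Edge-sym {G} e) c₁₃∈
      κe-available 3F 1F e = LavE-comm L φ (Edge-sym {G} e) c₂₄∈
      κe-available 0F 0F e = ⊥-elim (no-loop e)
      κe-available 1F 1F e = ⊥-elim (no-loop e)
      κe-available 2F 2F e = ⊥-elim (no-loop e)
      κe-available 3F 3F e = ⊥-elim (no-loop e)

      κe-sym : ∀ i j → Edge G (corner i) (corner j) → κe i j ≡ κe j i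
      κe-sym 0F 0F _ = refl
      κe-sym 0F 1F _ = refl
      κe-sym 0F 2F _ = refl
      κe-sym 0F 3F _ = refl
      κe-sym 1F 0F _ = refl
      κe-sym 1F 1F _ = refl
      κe-sym 1F 2F _ = refl
      κe-sym 1F 3F _ = refl
      κe-sym 2F 0F _ = refl
      κe-sym 2F 1F _ = refl
      κe-sym 2F 2F _ = refl
      κe-sym 2F 3F _ = refl
      κe-sym 3F 0F _ = refl
      κe-sym 3F 1F _ = refl
      κe-sym 3F 2F _ = refl
      κe-sym 3F 3F _ = refl

      κv≢κv : ∀ i j → Edge G (corner i) (corner j) → κv i ≢ κv j
      κv≢κv 0F 1F _ = c₁≢c₂
      κv≢κv 0F 2F _ = c₁≢c₃
      κv≢κv 0F 3F _ = c₁≢c₄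
      κv≢κv 1F 2F _ = c₂≢c₃
      κv≢κv 1F 3F _ = c₂≢c₄
      κv≢κv 2F 3F _ = c₃≢c₄
      κv≢κv 1F 0F _ = ≢-sym c₁≢c₂
      κv≢κv 2F 0F _ = ≢-sym c₁≢c₃
      κv≢κv 3F 0F _ = ≢-sym c₁≢c₄
      κv≢κv 2F 1F _ = ≢-sym c₂≢c₃
      κv≢κv 3F 1F _ = ≢-sym c₂≢c₄
      κv≢κv 3F 2F _ = ≢-sym c₃≢c₄
      κv≢κv 0F 0F e = ⊥-elim (no-loop e)
      κv≢κv 1F 1F e = ⊥-elim (no-loop e)
      κv≢κv 2F 2F e = ⊥-elim (no-loop e)
      κv≢κv 3F 3F e = ⊥-elim (no-loop e)

      κv≢κe : ∀ i j → Edge G (corner i) (corner j) → κv i ≢ κe i j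
      κv≢κe 0F 1F _ = c₁≢c₁₂
      κv≢κe 0F 2F _ = c₁≢c₁₃
      κv≢κe 0F 3F _ = c₁≢c₁₄
      κv≢κe 1F 0F _ = c₂≢c₁₂
      κv≢κe 1F 2F _ = c₂≢c₂₃
      κv≢κe 1F 3F _ = c₂≢c₂₄
      κv≢κe 2F 0F _ = c₃≢c₁₃
      κv≢κe 2F 1F _ = c₃≢c₂₃
      κv≢κe 2F 3F _ = c₃≢c₃₄
      κv≢κe 3F 0F _ = c₄≢c₁₄
      κv≢κe 3F 1F _ = c₄≢c₂₄
      κv≢κe 3F 2F _ = c₄≢c₃₄
      κv≢κe 0F 0F e = ⊥-elim (no-loop e)
      κv≢κe 1F 1F e = ⊥-elim (no-loop e)
      κv≢κe 2F 2F e = ⊥-elim (no-loop e)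
      κv≢κe 3F 3F e = ⊥-elim (no-loop e)

      κe≢κe : ∀ i j l → Edge G (corner i) (corner j) → Edge G (corner i) (corner l) → j ≢ l → κe i j ≢ κe i l
      κe≢κe 0F 0F _ e _ _ = ⊥-elim (no-loop e)
      κe≢κe 1F 1F _ e _ _ = ⊥-elim (no-loop e)
      κe≢κe 2F 2F _ e _ _ = ⊥-elim (no-loop e)
      κe≢κe 3F 3F _ e _ _ = ⊥-elim (no-loop e)
      κe≢κe 0F _ 0F _ e _ = ⊥-elim (no-loop e)
      κe≢κe 1F _ 1F _ e _ = ⊥-elim (no-loop e)
      κe≢κe 2F _ 2F _ e _ = ⊥-elim (no-loop e)
      κe≢κe 3F _ 3F _ e _ = ⊥-elim (no-loop e)
      κe≢κe _ 0F 0F _ _ j≢l = ⊥-elim (j≢l refl)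
      κe≢κe _ 1F 1F _ _ j≢l = ⊥-elim (j≢l refl)
      κe≢κe _ 2F 2F _ _ j≢l = ⊥-elim (j≢l refl)
      κe≢κe _ 3F 3F _ _ j≢l = ⊥-elim (j≢l refl)
      κe≢κe 0F 1F 2F _ _ _ = c₁₂≢c₁₃
      κe≢κe 0F 1F 3F _ _ _ = c₁₂≢c₁₄
      κe≢κe 0F 2F 3F _ _ _ = c₁₃≢c₁₄
      κe≢κe 0F 2F 1F _ _ _ = ≢-sym c₁₂≢c₁₃
      κe≢κe 0F 3F 1F _ _ _ = ≢-sym c₁₂≢c₁₄
      κe≢κe 0F 3F 2F _ _ _ = ≢-sym c₁₃≢c₁₄
      κe≢κe 1F 0F 2F _ _ _ = c₁₂≢c₂₃
      κe≢κe 1F 0F 3F _ _ _ = c₁₂≢c₂₄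
      κe≢κe 1F 2F 3F _ _ _ = c₂₃≢c₂₄
      κe≢κe 1F 2F 0F _ _ _ = ≢-sym c₁₂≢c₂₃
      κe≢κe 1F 3F 0F _ _ _ = ≢-sym c₁₂≢c₂₄
      κe≢κe 1F 3F 2F _ _ _ = ≢-sym c₂₃≢c₂₄
      κe≢κe 2F 0F 1F _ _ _ = c₁₃≢c₂₃
      κe≢κe 2F 0F 3F _ _ _ = c₁₃≢c₃₄
      κe≢κe 2F 1F 3F _ _ _ = c₂₃≢c₃₄
      κe≢κe 2F 1F 0F _ _ _ = ≢-sym c₁₃≢c₂₃
      κe≢κe 2F 3F 0F _ _ _ = ≢-sym c₁₃≢c₃₄
      κe≢κe 2F 3F 1F _ _ _ = ≢-sym c₂₃≢c₃₄
      κe≢κe 3F 0F 1F _ _ _ = c₁₄≢c₂₄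
      κe≢κe 3F 0F 2F _ _ _ = c₁₄≢c₃₄
      κe≢κe 3F 1F 2F _ _ _ = c₂₄≢c₃₄
      κe≢κe 3F 1F 0F _ _ _ = ≢-sym c₁₄≢c₂₄
      κe≢κe 3F 2F 0F _ _ _ = ≢-sym c₁₄≢c₃₄
      κe≢κe 3F 2F 1F _ _ _ = ≢-sym c₂₄≢c₃₄

lemma3p5 : (G : Graph) (L : ListAssignment G) (u₁ u₂ u₃ u₄ : Vtx G) →
    u₁ ≢ u₂ → u₁ ≢ u₃ → u₁ ≢ u₄ → u₂ ≢ u₃ → u₂ ≢ u₄ → u₃ ≢ u₄ →
    Edge G u₁ u₂ → Edge G u₂ u₃ → Edge G u₃ u₄ → Edge G u₄ u₁ →
    Edge G u₁ u₃ → Edge G u₂ u₄ →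
    deg G u₂ ≡ 3 → deg G u₄ ≡ 3 →
    (φ : PartialCol G) → IsPartialLTotal G L φ →
    (∀ v → (pv φ v ≡ nothing) ⇔ (v ≡ u₁ ⊎ v ≡ u₂ ⊎ v ≡ u₃ ⊎ v ≡ u₄)) →
    (∀ u v → Edge G u v →
      (pe φ u v ≡ nothing) ⇔
        (SamePair u₁ u₂ u v ⊎ SamePair u₂ u₃ u v ⊎ SamePair u₃ u₄ u v ⊎
         SamePair u₁ u₄ u v ⊎ SamePair u₂ u₄ u v ⊎ SamePair u₁ u₃ u v)) →
    6 ≤ card (LavV G L φ u₂) → 6 ≤ card (LavV G L φ u₄) → 6 ≤ card (LavE G L φ u₂ u₄) →
    4 ≤ card (LavE G L φ u₁ u₂) → 4 ≤ card (LavE G L φ u₂ u₃) →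
    4 ≤ card (LavE G L φ u₃ u₄) → 4 ≤ card (LavE G L φ u₁ u₄) →
    2 ≤ card (LavV G L φ u₁) → 2 ≤ card (LavV G L φ u₃) → 2 ≤ card (LavE G L φ u₁ u₃) →
    (card (LavV G L φ u₁) ≡ 2 → card (LavV G L φ u₃) ≡ 2 → card (LavE G L φ u₁ u₃) ≡ 2 →
      ¬ ((LavV G L φ u₁ ≈ₛ LavV G L φ u₃) × (LavV G L φ u₃ ≈ₛ LavE G L φ u₁ u₃))) →
    ∃₂ λ (cv : Vtx G → ℕ) (ce : Vtx G → Vtx G → ℕ) →
      IsLTotal G L cv ce × Extends G φ cv ce
lemma3p5 G L u₁ u₂ u₃ u₄ _ _ _ _ _ _ _ _ _ _ _ _ _ _ φ φ-proper uncoloured-vertices uncoloured-edges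
         6≤A₂ 6≤A₄ 6≤A₂₄ 4≤A₁₂ 4≤A₂₃ 4≤A₃₄ 4≤A₁₄ 2≤A₁ 2≤A₃ 2≤A₁₃ not-all-same =
  extension (corner-colouring (k4-colouring available bounds))
  where
  open K4Corners L φ u₁ u₂ u₃ u₄
  open Completion φ-proper uncoloured-vertices uncoloured-edges
  bounds : K4Bounds available
  bounds = record
    { 2≤A₁ = 2≤A₁ ; 6≤A₂ = 6≤A₂ ; 2≤A₃ = 2≤A₃ ; 6≤A₄ = 6≤A₄
    ; 4≤A₁₂ = 4≤A₁₂ ; 4≤A₂₃ = 4≤A₂₃ ; 4≤A₃₄ = 4≤A₃₄ ; 4≤A₁₄ = 4≤A₁₄
    ; 2≤A₁₃ = 2≤A₁₃ ; 6≤A₂₄ = 6≤A₂₄ ; not-all-same = not-all-same }
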